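{- Let $n\geq 1$. Form a random subgraph $G_\omega$ of the complete bipartite graph $K_{n,n}$ (on the same vertex set) by ordering the $n^2$ edges of $K_{n,n}$ uniformly at random and adding edges in this order, stopping at the first moment when every vertex has degree at least one. Then the expected number of perfect matchings contained in $G_\omega$ is $$n!\left(\frac{2}{\binom{2n-1}{n}}-\frac{1}{\binom{3n-2}{n}}\right).$$
   Context: A perfect (complete) matching is a subgraph on the full vertex set in which every vertex has degree exactly $1$. -}

module Defs where

open import Data.Nat using (ℕ; zero; suc; _*_; _≤_; _≤?_; _≟_)
open import Data.Integer using (+_)
open import Data.Fin using (Fin)
open import Data.Fin.Properties using () renaming (_≟_ to _≟ᶠ_)
open import Data.Product using (_×_; _,_; proj₁; proj₂)
open import Data.Product.Properties using (≡-dec)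
open import Data.Sum using (_⊎_; inj₁; inj₂)
open import Data.List using (List; []; _∷_; _++_; [_]; length; filter; map; concatMap; allFin; inits; cartesianProduct)
open import Data.Nat.ListAction using (sum)
open import Data.List.Relation.Unary.All using (All)
open import Data.List.Relation.Unary.All.Properties using ()
import Data.List.Relation.Unary.All as All
open import Data.Rational using (ℚ; 0ℚ; _÷_; ≢-nonZero)
import Data.Rational as ℚ
open import Data.Rational.Properties using () renaming (_≟_ to _≟ℚ_)
open import Relation.Nullary using (Dec; yes; no; ¬_)
open import Relation.Unary using (Decidable)
open import Relation.Binary.PropositionalEquality using (_≡_)

Vertex : ℕ → Set
Vertex n = Fin n ⊎ Fin n

-- An edge of K_{n,n}: (left endpoint , right endpoint).
Edge : ℕ → Set
Edge n = Fin n × Fin n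

allVertices : (n : ℕ) → List (Vertex n)
allVertices n = map inj₁ (allFin n) ++ map inj₂ (allFin n)

allEdges : (n : ℕ) → List (Edge n)
allEdges n = cartesianProduct (allFin n) (allFin n)

Incident : ∀ {n} → Vertex n → Edge n → Set
Incident (inj₁ i) e = proj₁ e ≡ i
Incident (inj₂ j) e = proj₂ e ≡ j

incident? : ∀ {n} (v : Vertex n) → Decidable (Incident v)
incident? (inj₁ i) e = proj₁ e ≟ᶠ i
incident? (inj₂ j) e = proj₂ e ≟ᶠ j

degree : ∀ {n} → Vertex n → List (Edge n) → ℕ
degree v S = length (filter (incident? v) S)

NoIsolated : ∀ {n} → List (Edge n) → Set
NoIsolated {n} S = All (λ v → 1 ≤ degree v S) (allVertices n)

noIsolated? : ∀ {n} → Decidable (NoIsolated {n})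
noIsolated? {n} S = All.all? (λ v → 1 ≤? degree v S) (allVertices n)

IsPerfectMatching : ∀ {n} → List (Edge n) → Set
IsPerfectMatching {n} S = All (λ v → degree v S ≡ 1) (allVertices n)

isPerfectMatching? : ∀ {n} → Decidable (IsPerfectMatching {n})
isPerfectMatching? {n} S = All.all? (λ v → degree v S ≟ 1) (allVertices n)

-- all sub-lists (= all edge subsets, for a duplicate-free list)
sublists : ∀ {A : Set} → List A → List (List A)
sublists [] = [] ∷ []
sublists (x ∷ xs) = sublists xs ++ map (x ∷_) (sublists xs)

insertions : ∀ {A : Set} → A → List A → List (List A)
insertions x [] = [ x ∷ [] ]
insertions x (y ∷ ys) = (x ∷ y ∷ ys) ∷ map (y ∷_) (insertions x ys)

permutations : ∀ {A : Set} → List A → List (List A)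
permutations [] = [ [] ]
permutations (x ∷ xs) = concatMap (insertions x) (permutations xs)

firstSat : ∀ {A : Set} {P : A → Set} → Decidable P → A → List A → A
firstSat P? d [] = d
firstSat P? d (x ∷ xs) with P? x
... | yes _ = x
... | no _ = firstSat P? d xs

-- G_ω: add the edges of the ordering ω one by one, stopping at the first
-- moment every vertex has degree ≥ 1 (shortest such prefix of ω).
stoppedGraph : ∀ {n} → List (Edge n) → List (Edge n)
stoppedGraph ω = firstSat noIsolated? ω (inits ω)

numPerfectMatchings : ∀ {n} → List (Edge n) → ℕ
numPerfectMatchings G = length (filter isPerfectMatching? (sublists G))

-- all orderings of the n² edges of K_{n,n}; uniform measure on this list
orderings : (n : ℕ) → List (List (Edge n))
orderings n = permutations (allEdges n)

ℕtoℚ : ℕ → ℚ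
ℕtoℚ k = (+ k) ℚ./ 1

-- total division on ℚ (x / 0 = 0); only used with nonzero denominators
_/ℚ_ : ℚ → ℚ → ℚ
p /ℚ q with q ≟ℚ 0ℚ
... | yes _ = 0ℚ
... | no q≢0 = _÷_ p q {{≢-nonZero q≢0}}

expectedPM : ℕ → ℚ
expectedPM n = ℕtoℚ (sum (map (λ ω → numPerfectMatchings (stoppedGraph ω)) (orderings n)))
               /ℚ ℕtoℚ (length (orderings n))

{-# OPTIONS --safe #-}
-- Fix a perfect matching S and an ordering ω, and let e₀ be the last edge of S in ω, preceded by the
-- edges P.  The stopped graph G_ω is the shortest prefix of ω without isolated vertices, so S ⊆ G_ω iff
-- P has an isolated vertex, and since every other vertex is covered by its edge of S in P, such a vertex
-- is an endpoint of e₀.  Inclusion–exclusion over the two endpoints of e₀ gives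
--   [S ⊆ G_ω] + Σ_{e ∈ S} B_e(ω) = Σ_{e ∈ S} (R_e(ω) + C_e(ω)),
-- where R_e (C_e, B_e) is the event that the other edges of S come before e and the other edges at the
-- row (column, either) endpoint of e come after it.  Such an event fixes the relative order of e, the
-- n − 1 other edges of S and k further edges, so it has probability (n − 1)! k! / (n + k)! =
-- 1 / (n C(n + k, n)), with k = n − 1 for R_e and C_e and k = 2n − 2 for B_e.  Summing over the n edges
-- of S and the n! perfect matchings gives n! (2 / C(2n − 1, n) − 1 / C(3n − 2, n)).
module Submission where

open import Algebra.Bundles using (CommutativeMonoid; CommutativeSemigroup)
open import Algebra.Properties.CommutativeSemigroup using (interchange; x∙yz≈y∙xz)
open import Data.Bool.Base using (Bool; true; false; not; _∧_; _∨_; T)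
open import Data.Bool.ListAction using (all; and)
open import Data.Bool.Properties using (∧-assoc; ∧-zeroʳ; ∧-identityʳ; ∧-commutativeMonoid)
open import Data.Fin.Base using (Fin; zero)
open import Data.Fin.Properties using () renaming (_≟_ to _≟ᶠ_)
import Data.Integer.Base as ℤ
import Data.Integer.Properties as ℤₚ
open import Data.List.Base
  using (List; []; _∷_; _++_; [_]; length; map; concatMap; filter; filterᵇ; allFin; cartesianProduct; inits)
open import Data.List.Membership.Propositional using (_∈_; _∉_; find)
open import Data.List.Membership.Propositional.Properties
  using (∈-map⁺; ∈-map⁻; ∈-++⁺ˡ; ∈-++⁺ʳ; ∈-++⁻; ∈-concat⁻′; ∈-allFin; ∈-cartesianProduct⁺; ∈-cartesianProduct⁻;
         ∈-filter⁺; ∈-filter⁻)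
import Data.List.Membership.DecPropositional as DecMembership
open import Data.List.Properties
  using (map-++; map-∘; length-map; length-++; length-tabulate; filter-++; filter-all; filter-none)
open import Data.List.Relation.Binary.Permutation.Propositional using (_↭_; ↭-refl; ↭-trans; ↭-sym; ↭⇒↭ₛ)
import Data.List.Relation.Binary.Permutation.Propositional as ↭
open import Data.List.Relation.Binary.Permutation.Propositional.Properties
  using (↭-length; ∈-resp-↭; shift; ++⁺ˡ; filter-↭)
import Data.List.Relation.Binary.Permutation.Setoid.Properties as PermutationProperties
open import Data.List.Relation.Unary.All using (All; []; _∷_)
import Data.List.Relation.Unary.All as All
open import Data.List.Relation.Unary.All.Properties using (All¬⇒¬Any; ¬Any⇒All¬)
open import Data.List.Relation.Unary.Any using (Any; any?; here; there; tail)
import Data.List.Relation.Unary.Any as Any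
open import Data.List.Relation.Unary.Unique.Propositional using (Unique; []; _∷_)
open import Data.List.Relation.Unary.Unique.Propositional.Properties using (allFin⁺; cartesianProduct⁺)
open import Data.Nat.Base using (ℕ; zero; suc; _+_; _*_; _∸_; _≤_; _!; _/_; s≤s; z≤n; ≢-nonZero⁻¹)
open import Data.Nat.Combinatorics using (_C_; k![n∸k]!∣n!)
open import Data.Nat.Combinatorics.Specification using (nCk≡n!/k![n-k]!)
import Data.Nat.Coprimality as Coprimality
open import Data.Nat.DivMod using (m/n*n≡m)
open import Data.Nat.ListAction using (sum)
open import Data.Nat.ListAction.Properties using (sum-++)
open import Data.Nat.Properties
  using (+-identityʳ; +-comm; +-suc; +-commutativeSemigroup; *-identityʳ; *-identityˡ; *-zeroʳ; *-comm; *-assoc;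
         *-distribˡ-+; *-distribʳ-+; *-cancelʳ-≡; suc-injective; m+n∸m≡n; m≤m+n; ≤-trans; ≤-reflexive; _!≢0; _!*_!≢0)
  renaming (_≟_ to _≟ℕ_)
open import Data.Nat.Tactic.RingSolver using (solve-∀)
open import Data.Product.Base using (_×_; _,_; ∃; proj₁; proj₂)
open import Data.Product.Properties using (≡-dec; ×-≡,≡→≡)
open import Data.Rational using (ℚ; _-_)
import Data.Rational as ℚ
import Data.Rational.Properties as ℚₚ
open import Data.Rational.Solver using (module +-*-Solver)
open import Data.Sum.Base using (inj₁; inj₂)
open import Function.Base using (_∘_)
open import Function.Bundles using (_⇔_; mk⇔; Equivalence)
open import Relation.Binary.Definitions using (DecidableEquality)
open import Relation.Binary.PropositionalEquality
  using (_≡_; _≢_; refl; sym; trans; cong; cong₂; subst; subst₂; setoid; module ≡-Reasoning)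
open import Relation.Nullary using (Dec; yes; no; does; ¬_)
open import Relation.Nullary.Decidable using (T?; dec-true; dec-false; does-⇔)
open import Relation.Nullary.Negation using (contradiction)
open import Relation.Unary using (Decidable)
open import Level using (0ℓ)

open import Defs

private variable
  A B : Set

𝟙 : Bool → ℕ
𝟙 true = 1
𝟙 false = 0

𝟙-∧ : ∀ a b → 𝟙 (a ∧ b) ≡ 𝟙 a * 𝟙 b
𝟙-∧ true b = sym (+-identityʳ (𝟙 b))
𝟙-∧ false b = refl

𝟙-∨ : ∀ a b → 𝟙 (a ∨ b) + 𝟙 (a ∧ b) ≡ 𝟙 a + 𝟙 b
𝟙-∨ true true = refl
𝟙-∨ true false = refl
𝟙-∨ false true = refl
𝟙-∨ false false = refl

𝟙-split : ∀ a b → 𝟙 a ≡ 𝟙 (a ∧ not b) + 𝟙 (a ∧ b)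
𝟙-split true true = refl
𝟙-split true false = refl
𝟙-split false b = refl

∧-commutativeSemigroup : CommutativeSemigroup 0ℓ 0ℓ
∧-commutativeSemigroup = CommutativeMonoid.commutativeSemigroup ∧-commutativeMonoid

∧-left-comm : ∀ a b c → a ∧ (b ∧ c) ≡ b ∧ (a ∧ c)
∧-left-comm = x∙yz≈y∙xz ∧-commutativeSemigroup

not-∨ : ∀ a b → not (a ∨ b) ≡ not a ∧ not b
not-∨ true b = refl
not-∨ false b = refl

true⇔true⇒≡ : ∀ {a b} → (a ≡ true → b ≡ true) → (b ≡ true → a ≡ true) → a ≡ b
true⇔true⇒≡ {true} a⇒b _ = sym (a⇒b refl)
true⇔true⇒≡ {false} {true} _ b⇒a = b⇒a refl
true⇔true⇒≡ {false} {false} _ _ = refl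

∧-true : ∀ {a b} → a ∧ b ≡ true → a ≡ true × b ≡ true
∧-true {true} {true} _ = refl , refl

not-true : ∀ {a} → not a ≡ true → a ≡ false
not-true {false} _ = refl

not-false : ∀ {a} → not a ≡ false → a ≡ true
not-false {true} _ = refl

does-true : ∀ {P : Set} (P? : Dec P) → does P? ≡ true → P
does-true (yes p) _ = p

does-false : ∀ {P : Set} (P? : Dec P) → does P? ≡ false → ¬ P
does-false (no ¬p) _ = ¬p

all-cong : ∀ {f g : A → Bool} xs → (∀ {x} → x ∈ xs → f x ≡ g x) → all f xs ≡ all g xs
all-cong [] _ = refl
all-cong (x ∷ xs) f≡g = cong₂ _∧_ (f≡g (here refl)) (all-cong xs (f≡g ∘ there))

all-true : ∀ {f : A → Bool} xs → (∀ {x} → x ∈ xs → f x ≡ true) → all f xs ≡ true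
all-true [] _ = refl
all-true (x ∷ xs) f≡ = cong₂ _∧_ (f≡ (here refl)) (all-true xs (f≡ ∘ there))

all-lookup : ∀ {f : A → Bool} xs → all f xs ≡ true → ∀ {x} → x ∈ xs → f x ≡ true
all-lookup {f = f} (y ∷ xs) all≡ (here refl) with f y
... | true = refl
all-lookup {f = f} (y ∷ xs) all≡ (there x∈) with f y
... | true = all-lookup xs all≡ x∈

all-false : ∀ {f : A → Bool} xs → all f xs ≡ false → Any (λ x → f x ≡ false) xs
all-false {f = f} (y ∷ xs) all≡ with f y in fy
... | true = there (all-false xs all≡)
... | false = here fy

all-∈-false : ∀ {f : A → Bool} {x} xs → x ∈ xs → f x ≡ false → all f xs ≡ false
all-∈-false {f = f} (y ∷ xs) (here refl) fx = trans (cong (_∧ all f xs) fx) refl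
all-∈-false {f = f} (y ∷ xs) (there x∈) fx = trans (cong (f y ∧_) (all-∈-false xs x∈ fx)) (∧-zeroʳ (f y))

all-∧ : ∀ (f g : A → Bool) xs → all (λ x → f x ∧ g x) xs ≡ all f xs ∧ all g xs
all-∧ f g [] = refl
all-∧ f g (x ∷ xs) =
  trans (cong ((f x ∧ g x) ∧_) (all-∧ f g xs)) (interchange ∧-commutativeSemigroup (f x) (g x) (all f xs) (all g xs))

all-++ : ∀ (f : A → Bool) xs ys → all f (xs ++ ys) ≡ all f xs ∧ all f ys
all-++ f [] ys = refl
all-++ f (x ∷ xs) ys = trans (cong (f x ∧_) (all-++ f xs ys)) (sym (∧-assoc (f x) (all f xs) (all f ys)))

all-map : ∀ (f : B → Bool) (g : A → B) xs → all f (map g xs) ≡ all (f ∘ g) xs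
all-map f g xs = cong and (sym (map-∘ xs))

all-↭ : ∀ (f : A → Bool) {xs ys} → xs ↭ ys → all f xs ≡ all f ys
all-↭ f ↭.refl = refl
all-↭ f (↭.prep x p) = cong (f x ∧_) (all-↭ f p)
all-↭ f (↭.swap x y p) = trans (cong (λ r → f x ∧ (f y ∧ r)) (all-↭ f p))
  (∧-left-comm (f x) (f y) _)
all-↭ f (↭.trans p q) = trans (all-↭ f p) (all-↭ f q)

all-single : ∀ {X Y : A → Bool} {c} b xs → Unique xs → c ∈ xs →
  (∀ {j} → j ∈ xs → j ≢ c → X j ≡ Y j) → X c ≡ b ∧ Y c → all X xs ≡ b ∧ all Y xs
all-single {X = X} {Y} b (c ∷ xs) (c∉ ∷ _) (here refl) X≡Y Xc =
  trans (cong₂ _∧_ Xc (all-cong xs (λ j∈ → X≡Y (there j∈) (λ { refl → All.lookup c∉ j∈ refl }))))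
        (∧-assoc b (Y c) (all Y xs))
all-single {X = X} {Y} b (y ∷ xs) (y∉ ∷ u) (there c∈) X≡Y Xc =
  trans (cong₂ _∧_ (X≡Y (here refl) (λ { refl → All.lookup y∉ c∈ refl })) (all-single b xs u c∈ (X≡Y ∘ there) Xc))
        (∧-left-comm (Y y) b (all Y xs))

does-all? : ∀ {P : A → Set} (P? : Decidable P) xs → does (All.all? P? xs) ≡ all (does ∘ P?) xs
does-all? P? [] = refl
does-all? P? (x ∷ xs) = cong (does (P? x) ∧_) (does-all? P? xs)

∑ : (A → ℕ) → List A → ℕ
∑ f xs = sum (map f xs)

∑-++ : ∀ (f : A → ℕ) xs ys → ∑ f (xs ++ ys) ≡ ∑ f xs + ∑ f ys
∑-++ f xs ys = trans (cong sum (map-++ f xs ys)) (sum-++ (map f xs) (map f ys))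

∑-map : ∀ (f : B → ℕ) (g : A → B) xs → ∑ f (map g xs) ≡ ∑ (f ∘ g) xs
∑-map f g xs = cong sum (sym (map-∘ xs))

∑-concatMap : ∀ (f : B → ℕ) (g : A → List B) xs → ∑ f (concatMap g xs) ≡ ∑ (∑ f ∘ g) xs
∑-concatMap f g [] = refl
∑-concatMap f g (x ∷ xs) =
  trans (∑-++ f (g x) (concatMap g xs)) (cong (∑ f (g x) +_) (∑-concatMap f g xs))

∑-cong : ∀ {f g : A → ℕ} xs → (∀ {x} → x ∈ xs → f x ≡ g x) → ∑ f xs ≡ ∑ g xs
∑-cong [] f≡g = refl
∑-cong (x ∷ xs) f≡g = cong₂ _+_ (f≡g (here refl)) (∑-cong xs (f≡g ∘ there))

∑-+ : ∀ (f g : A → ℕ) xs → ∑ (λ x → f x + g x) xs ≡ ∑ f xs + ∑ g xs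
∑-+ f g [] = refl
∑-+ f g (x ∷ xs) = trans (cong (f x + g x +_) (∑-+ f g xs))
  (interchange +-commutativeSemigroup (f x) (g x) (∑ f xs) (∑ g xs))

∑-*ˡ : ∀ k (f : A → ℕ) xs → ∑ (λ x → k * f x) xs ≡ k * ∑ f xs
∑-*ˡ k f [] = sym (*-zeroʳ k)
∑-*ˡ k f (x ∷ xs) = trans (cong (k * f x +_) (∑-*ˡ k f xs)) (sym (*-distribˡ-+ k (f x) (∑ f xs)))

∑-*ʳ : ∀ (f : A → ℕ) k xs → ∑ f xs * k ≡ ∑ (λ x → f x * k) xs
∑-*ʳ f k xs = trans (*-comm (∑ f xs) k) (trans (sym (∑-*ˡ k f xs)) (∑-cong xs (λ {x} _ → *-comm k (f x))))

∑-const : ∀ k (xs : List A) → ∑ (λ _ → k) xs ≡ length xs * k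
∑-const k [] = refl
∑-const k (x ∷ xs) = cong (k +_) (∑-const k xs)

∑-scaled : ∀ (f : A → ℕ) k c xs → (∀ {x} → x ∈ xs → f x * k ≡ c) → ∑ f xs * k ≡ length xs * c
∑-scaled f k c xs f*k≡c = trans (∑-*ʳ f k xs) (trans (∑-cong xs f*k≡c) (∑-const c xs))

∑-zero : ∀ {f : A → ℕ} xs → (∀ {x} → x ∈ xs → f x ≡ 0) → ∑ f xs ≡ 0
∑-zero [] _ = refl
∑-zero (x ∷ xs) f≡0 = cong₂ _+_ (f≡0 (here refl)) (∑-zero xs (f≡0 ∘ there))

∑-comm : ∀ (f : A → B → ℕ) xs ys → ∑ (λ x → ∑ (f x) ys) xs ≡ ∑ (λ y → ∑ (λ x → f x y) xs) ys
∑-comm f [] ys = sym (∑-zero ys (λ _ → refl))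
∑-comm f (x ∷ xs) ys =
  trans (cong (∑ (f x) ys +_) (∑-comm f xs ys)) (sym (∑-+ (f x) (λ y → ∑ (λ x → f x y) xs) ys))

∑-single : ∀ {f : A → ℕ} {x} xs → Unique xs → x ∈ xs → (∀ {y} → y ∈ xs → y ≢ x → f y ≡ 0) →
  ∑ f xs ≡ f x
∑-single {f = f} (x ∷ xs) (x∉xs ∷ _) (here refl) others =
  trans (cong (f x +_) (∑-zero xs (λ y∈ → others (there y∈) (λ { refl → All.lookup x∉xs y∈ refl }))))
        (+-identityʳ (f x))
∑-single {f = f} (y ∷ xs) (y∉xs ∷ u) (there x∈) others =
  cong₂ _+_ (others (here refl) (λ { refl → All.lookup y∉xs x∈ refl })) (∑-single xs u x∈ (others ∘ there))

length≡∑1 : (xs : List A) → length xs ≡ ∑ (λ _ → 1) xs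
length≡∑1 [] = refl
length≡∑1 (x ∷ xs) = cong suc (length≡∑1 xs)

length-filter : ∀ {P : A → Set} (P? : Decidable P) xs → length (filter P? xs) ≡ ∑ (λ x → 𝟙 (does (P? x))) xs
length-filter P? [] = refl
length-filter P? (x ∷ xs) with does (P? x)
... | true = cong suc (length-filter P? xs)
... | false = length-filter P? xs

All-filterᵇ : ∀ (f : A → Bool) xs → All (λ x → f x ≡ true) (filterᵇ f xs)
All-filterᵇ f [] = []
All-filterᵇ f (x ∷ xs) with f x in fx
... | true = fx ∷ All-filterᵇ f xs
... | false = All-filterᵇ f xs

Unique-resp-↭ : ∀ {xs ys : List A} → xs ↭ ys → Unique xs → Unique ys
Unique-resp-↭ {A = A} p = PermutationProperties.Unique-resp-↭ (setoid A) (↭⇒↭ₛ p)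

Unique-++-∷ : ∀ {x : A} xs {ys} → Unique (xs ++ x ∷ ys) → x ∉ xs
Unique-++-∷ (y ∷ xs) (y∉ ∷ _) (here refl) = All.lookup y∉ (∈-++⁺ʳ xs (here refl)) refl
Unique-++-∷ (y ∷ xs) (_ ∷ u) (there x∈) = Unique-++-∷ xs u x∈

last-split : ∀ {Q : A → Set} (Q? : Decidable Q) xs → Any Q xs →
  ∃ λ P → ∃ λ x → ∃ λ B → xs ≡ P ++ x ∷ B × Q x × All (¬_ ∘ Q) B
last-split Q? (y ∷ ys) Q-xs with any? Q? ys
... | yes Q-ys with last-split Q? ys Q-ys
...   | P , x , B , refl , Qx , ¬QB = y ∷ P , x , B , refl , Qx , ¬QB
last-split Q? (y ∷ ys) (here Qy) | no ¬Q-ys = [] , y , ys , refl , Qy , ¬Any⇒All¬ ys ¬Q-ys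
last-split Q? (y ∷ ys) (there Q-ys) | no ¬Q-ys = contradiction Q-ys ¬Q-ys

∈-concatMap⁻ : ∀ (f : A → List B) xs {y} → y ∈ concatMap f xs → ∃ λ x → x ∈ xs × y ∈ f x
∈-concatMap⁻ f xs y∈ with ∈-concat⁻′ (map f xs) y∈
... | ys , y∈ys , ys∈ with ∈-map⁻ f ys∈
...   | x , x∈ , refl = x , x∈ , y∈ys

↭-insertions : ∀ (x : A) l {ω} → ω ∈ insertions x l → ω ↭ x ∷ l
↭-insertions x [] (here refl) = ↭-refl
↭-insertions x (y ∷ l) (here refl) = ↭-refl
↭-insertions x (y ∷ l) (there ω∈) with ∈-map⁻ (y ∷_) ω∈
... | ω , ω∈′ , refl = ↭-trans (↭.prep y (↭-insertions x l ω∈′)) (↭.swap y x ↭-refl)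

length-insertions : ∀ (x : A) l → length (insertions x l) ≡ suc (length l)
length-insertions x [] = refl
length-insertions x (y ∷ l) = cong suc (trans (length-map (y ∷_) (insertions x l)) (length-insertions x l))

∉-insertions : ∀ {x y : A} {γ γ′} → x ≢ y → x ∉ γ → γ′ ∈ insertions y γ → x ∉ γ′
∉-insertions {γ = γ} x≢y x∉γ γ′∈ x∈γ′ with ∈-resp-↭ (↭-insertions _ γ γ′∈) x∈γ′
... | here x≡y = x≢y x≡y
... | there x∈γ = x∉γ x∈γ

length-∈-insertions : ∀ {y : A} {γ γ′} → γ′ ∈ insertions y γ → length γ′ ≡ suc (length γ)
length-∈-insertions {γ = γ} γ′∈ = ↭-length (↭-insertions _ γ γ′∈)

all-insertions : ∀ (f : A → Bool) {y γ γ′} → γ′ ∈ insertions y γ → all f γ′ ≡ f y ∧ all f γ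
all-insertions f {γ = γ} γ′∈ = all-↭ f (↭-insertions _ γ γ′∈)

insertions-++ : ∀ (y : A) α z β →
  insertions y (α ++ z ∷ β) ≡ map (_++ z ∷ β) (insertions y α) ++ map (λ β′ → α ++ z ∷ β′) (insertions y β)
insertions-++ y [] z β = refl
insertions-++ y (a ∷ α) z β = cong ((y ∷ a ∷ α ++ z ∷ β) ∷_) (begin
  map (a ∷_) (insertions y (α ++ z ∷ β))
    ≡⟨ cong (map (a ∷_)) (insertions-++ y α z β) ⟩
  map (a ∷_) (map (_++ z ∷ β) (insertions y α) ++ map (λ β′ → α ++ z ∷ β′) (insertions y β))
    ≡⟨ map-++ (a ∷_) (map (_++ z ∷ β) (insertions y α)) _ ⟩
  map (a ∷_) (map (_++ z ∷ β) (insertions y α)) ++ map (a ∷_) (map (λ β′ → α ++ z ∷ β′) (insertions y β))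
    ≡⟨ cong₂ _++_ (trans (sym (map-∘ (insertions y α))) (map-∘ (insertions y α))) (sym (map-∘ (insertions y β))) ⟩
  map (_++ z ∷ β) (map (a ∷_) (insertions y α)) ++ map (λ β′ → a ∷ α ++ z ∷ β′) (insertions y β) ∎)
  where open ≡-Reasoning

↭-permutations : ∀ (l : List A) {ω} → ω ∈ permutations l → ω ↭ l
↭-permutations [] (here refl) = ↭-refl
↭-permutations (x ∷ l) ω∈ with ∈-concatMap⁻ (insertions x) (permutations l) ω∈
... | π , π∈ , ω∈′ = ↭-trans (↭-insertions x π ω∈′) (↭.prep x (↭-permutations l π∈))

∈-permutations : ∀ {y : A} l {π} → π ∈ permutations l → y ∈ l → y ∈ π
∈-permutations l π∈ y∈ = ∈-resp-↭ (↭-sym (↭-permutations l π∈)) y∈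

∑-permutations-∷ : ∀ (g : List A → ℕ) k x l → (∀ {π} → π ∈ permutations l → ∑ g (insertions x π) ≡ k * g π) →
  ∑ g (permutations (x ∷ l)) ≡ k * ∑ g (permutations l)
∑-permutations-∷ g k x l ∑g≡ =
  trans (∑-concatMap g (insertions x) (permutations l)) (trans (∑-cong (permutations l) ∑g≡) (∑-*ˡ k g (permutations l)))

length-permutations : ∀ (l : List A) → length (permutations l) ≡ length l !
length-permutations [] = refl
length-permutations (x ∷ l) = begin
  length (permutations (x ∷ l))              ≡⟨ length≡∑1 (permutations (x ∷ l)) ⟩
  ∑ (λ _ → 1) (permutations (x ∷ l))         ≡⟨ ∑-permutations-∷ (λ _ → 1) (suc (length l)) x l ∑1≡ ⟩
  suc (length l) * ∑ (λ _ → 1) (permutations l) ≡⟨ cong (suc (length l) *_) (sym (length≡∑1 (permutations l))) ⟩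
  suc (length l) * length (permutations l)   ≡⟨ cong (suc (length l) *_) (length-permutations l) ⟩
  suc (length l) * length l !                ∎
  where
  open ≡-Reasoning
  ∑1≡ : ∀ {π} → π ∈ permutations l → ∑ (λ _ → 1) (insertions x π) ≡ suc (length l) * 1
  ∑1≡ {π} π∈ = begin
    ∑ (λ _ → 1) (insertions x π) ≡⟨ sym (length≡∑1 (insertions x π)) ⟩
    length (insertions x π)      ≡⟨ length-insertions x π ⟩
    suc (length π)               ≡⟨ cong suc (↭-length (↭-permutations l π∈)) ⟩
    suc (length l)               ≡⟨ sym (*-identityʳ _) ⟩
    suc (length l) * 1           ∎

∑-insertions-∷ : ∀ (f : List A → ℕ) x z ω →
  ∑ f (insertions x (z ∷ ω)) ≡ f (x ∷ z ∷ ω) + ∑ (f ∘ (z ∷_)) (insertions x ω)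
∑-insertions-∷ f x z ω = cong (f (x ∷ z ∷ ω) +_) (∑-map f (z ∷_) (insertions x ω))

private
  ∑∑-insertions-∷ : ∀ (g : List A → ℕ) x y z π →
    ∑ (∑ g ∘ insertions x) (insertions y (z ∷ π)) ≡
      g (x ∷ y ∷ z ∷ π) + g (y ∷ x ∷ z ∷ π)
      + (∑ (λ ω → g (y ∷ z ∷ ω)) (insertions x π) + ∑ (λ ω → g (x ∷ z ∷ ω)) (insertions y π))
      + ∑ (∑ (g ∘ (z ∷_)) ∘ insertions x) (insertions y π)
  ∑∑-insertions-∷ g x y z π = begin
    ∑ g (insertions x (y ∷ z ∷ π)) + ∑ (∑ g ∘ insertions x) (map (z ∷_) (insertions y π))
      ≡⟨ cong₂ _+_ (trans (∑-insertions-∷ g x y (z ∷ π))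
                          (cong (g (x ∷ y ∷ z ∷ π) +_) (∑-insertions-∷ (g ∘ (y ∷_)) x z π)))
                   (trans (∑-map (∑ g ∘ insertions x) (z ∷_) (insertions y π))
                          (trans (∑-cong (insertions y π) (λ {ω} _ → ∑-insertions-∷ g x z ω))
                                 (∑-+ (λ ω → g (x ∷ z ∷ ω)) (λ ω → ∑ (g ∘ (z ∷_)) (insertions x ω))
                                      (insertions y π)))) ⟩
    a + (b + c) + (d + e) ≡⟨ regroup a b c d e ⟩
    a + b + (c + d) + e ∎
    where
    open ≡-Reasoning
    regroup : ∀ a b c d e → a + (b + c) + (d + e) ≡ a + b + (c + d) + e
    regroup = solve-∀
    a b c d e : ℕ
    a = g (x ∷ y ∷ z ∷ π)
    b = g (y ∷ x ∷ z ∷ π)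
    c = ∑ (λ ω → g (y ∷ z ∷ ω)) (insertions x π)
    d = ∑ (λ ω → g (x ∷ z ∷ ω)) (insertions y π)
    e = ∑ (∑ (g ∘ (z ∷_)) ∘ insertions x) (insertions y π)

∑∑-insertions-comm : ∀ (g : List A → ℕ) x y π →
  ∑ (∑ g ∘ insertions x) (insertions y π) ≡ ∑ (∑ g ∘ insertions y) (insertions x π)
∑∑-insertions-comm g x y [] =
  cong (_+ 0) (x∙yz≈y∙xz +-commutativeSemigroup (g (x ∷ y ∷ [])) (g (y ∷ x ∷ [])) 0)
∑∑-insertions-comm g x y (z ∷ π) = begin
  ∑ (∑ g ∘ insertions x) (insertions y (z ∷ π))
    ≡⟨ ∑∑-insertions-∷ g x y z π ⟩
  g (x ∷ y ∷ z ∷ π) + g (y ∷ x ∷ z ∷ π) + (c + d) + ∑ (∑ (g ∘ (z ∷_)) ∘ insertions x) (insertions y π)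
    ≡⟨ cong₂ _+_ (cong₂ _+_ (+-comm (g (x ∷ y ∷ z ∷ π)) _) (+-comm c d)) (∑∑-insertions-comm (g ∘ (z ∷_)) x y π) ⟩
  g (y ∷ x ∷ z ∷ π) + g (x ∷ y ∷ z ∷ π) + (d + c) + ∑ (∑ (g ∘ (z ∷_)) ∘ insertions y) (insertions x π)
    ≡⟨ sym (∑∑-insertions-∷ g y x z π) ⟩
  ∑ (∑ g ∘ insertions y) (insertions x (z ∷ π)) ∎
  where
  open ≡-Reasoning
  c d : ℕ
  c = ∑ (λ ω → g (y ∷ z ∷ ω)) (insertions x π)
  d = ∑ (λ ω → g (x ∷ z ∷ ω)) (insertions y π)

∑-permutations-↭ : ∀ (g : List A → ℕ) {l l′} → l ↭ l′ → ∑ g (permutations l) ≡ ∑ g (permutations l′)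
∑-permutations-↭ g ↭.refl = refl
∑-permutations-↭ g (↭.trans p q) = trans (∑-permutations-↭ g p) (∑-permutations-↭ g q)
∑-permutations-↭ g {x ∷ l} {x ∷ l′} (↭.prep x p) = begin
  ∑ g (concatMap (insertions x) (permutations l))   ≡⟨ ∑-concatMap g (insertions x) (permutations l) ⟩
  ∑ (∑ g ∘ insertions x) (permutations l)           ≡⟨ ∑-permutations-↭ (∑ g ∘ insertions x) p ⟩
  ∑ (∑ g ∘ insertions x) (permutations l′)          ≡⟨ ∑-concatMap g (insertions x) (permutations l′) ⟨
  ∑ g (concatMap (insertions x) (permutations l′))  ∎
  where open ≡-Reasoning
∑-permutations-↭ g {x ∷ y ∷ l} {y ∷ x ∷ l′} (↭.swap x y p) = begin
  ∑ g (permutations (x ∷ y ∷ l))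
    ≡⟨ ∑-concatMap g (insertions x) (permutations (y ∷ l)) ⟩
  ∑ (∑ g ∘ insertions x) (concatMap (insertions y) (permutations l))
    ≡⟨ ∑-concatMap (∑ g ∘ insertions x) (insertions y) (permutations l) ⟩
  ∑ (∑ (∑ g ∘ insertions x) ∘ insertions y) (permutations l)
    ≡⟨ ∑-permutations-↭ (∑ (∑ g ∘ insertions x) ∘ insertions y) p ⟩
  ∑ (∑ (∑ g ∘ insertions x) ∘ insertions y) (permutations l′)
    ≡⟨ ∑-cong (permutations l′) (λ {π} _ → ∑∑-insertions-comm g x y π) ⟩
  ∑ (∑ (∑ g ∘ insertions y) ∘ insertions x) (permutations l′)
    ≡⟨ ∑-concatMap (∑ g ∘ insertions y) (insertions x) (permutations l′) ⟨
  ∑ (∑ g ∘ insertions y) (concatMap (insertions x) (permutations l′))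
    ≡⟨ ∑-concatMap g (insertions y) (permutations (x ∷ l′)) ⟨
  ∑ g (permutations (y ∷ x ∷ l′)) ∎
  where open ≡-Reasoning

∑-sublists-∷ : ∀ (h : List A → ℕ) x L → ∑ h (sublists (x ∷ L)) ≡ ∑ h (sublists L) + ∑ (h ∘ (x ∷_)) (sublists L)
∑-sublists-∷ h x L =
  trans (∑-++ h (sublists L) (map (x ∷_) (sublists L))) (cong (∑ h (sublists L) +_) (∑-map h (x ∷_) (sublists L)))

∑-sublists-↭ : ∀ (h : List A → ℕ) → (∀ {S S′} → S ↭ S′ → h S ≡ h S′) →
  ∀ {L L′} → L ↭ L′ → ∑ h (sublists L) ≡ ∑ h (sublists L′)
∑-sublists-↭ h h-↭ ↭.refl = refl
∑-sublists-↭ h h-↭ (↭.trans p q) = trans (∑-sublists-↭ h h-↭ p) (∑-sublists-↭ h h-↭ q)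
∑-sublists-↭ h h-↭ {x ∷ L} {x ∷ L′} (↭.prep x p) = begin
  ∑ h (sublists (x ∷ L))
    ≡⟨ ∑-sublists-∷ h x L ⟩
  ∑ h (sublists L) + ∑ (h ∘ (x ∷_)) (sublists L)
    ≡⟨ cong₂ _+_ (∑-sublists-↭ h h-↭ p) (∑-sublists-↭ (h ∘ (x ∷_)) (h-↭ ∘ ↭.prep x) p) ⟩
  ∑ h (sublists L′) + ∑ (h ∘ (x ∷_)) (sublists L′)
    ≡⟨ ∑-sublists-∷ h x L′ ⟨
  ∑ h (sublists (x ∷ L′)) ∎
  where open ≡-Reasoning
∑-sublists-↭ h h-↭ {x ∷ y ∷ L} {y ∷ x ∷ L′} (↭.swap x y p) = begin
  ∑ h (sublists (x ∷ y ∷ L))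
    ≡⟨ trans (∑-sublists-∷ h x (y ∷ L)) (cong₂ _+_ (∑-sublists-∷ h y L) (∑-sublists-∷ (h ∘ (x ∷_)) y L)) ⟩
  (a + b) + (c + d)
    ≡⟨ interchange +-commutativeSemigroup a b c d ⟩
  (a + c) + (b + d)
    ≡⟨ cong₂ _+_ (cong₂ _+_ (∑-sublists-↭ h h-↭ p) (∑-sublists-↭ (h ∘ (x ∷_)) (h-↭ ∘ ↭.prep x) p))
                 (cong₂ _+_ (∑-sublists-↭ (h ∘ (y ∷_)) (h-↭ ∘ ↭.prep y) p)
                            (trans (∑-cong (sublists L) (λ _ → h-↭ (↭.swap x y ↭-refl)))
                                   (∑-sublists-↭ (h ∘ (y ∷_) ∘ (x ∷_)) (h-↭ ∘ ↭.prep y ∘ ↭.prep x) p))) ⟩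
  (a′ + c′) + (b′ + d′)
    ≡⟨ trans (∑-sublists-∷ h y (x ∷ L′)) (cong₂ _+_ (∑-sublists-∷ h x L′) (∑-sublists-∷ (h ∘ (y ∷_)) x L′)) ⟨
  ∑ h (sublists (y ∷ x ∷ L′)) ∎
  where
  open ≡-Reasoning
  a b c d a′ b′ c′ d′ : ℕ
  a = ∑ h (sublists L)
  b = ∑ (h ∘ (y ∷_)) (sublists L)
  c = ∑ (h ∘ (x ∷_)) (sublists L)
  d = ∑ (h ∘ (x ∷_) ∘ (y ∷_)) (sublists L)
  a′ = ∑ h (sublists L′)
  b′ = ∑ (h ∘ (y ∷_)) (sublists L′)
  c′ = ∑ (h ∘ (x ∷_)) (sublists L′)
  d′ = ∑ (h ∘ (y ∷_) ∘ (x ∷_)) (sublists L′)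

∈-sublists⁻ : ∀ (L : List A) {S} → S ∈ sublists L → All (_∈ L) S
∈-sublists⁻ [] (here refl) = []
∈-sublists⁻ (x ∷ L) S∈ with ∈-++⁻ (sublists L) S∈
... | inj₁ S∈′ = All.map there (∈-sublists⁻ L S∈′)
... | inj₂ S∈′ with ∈-map⁻ (x ∷_) S∈′
...   | S , S∈″ , refl = here refl ∷ All.map there (∈-sublists⁻ L S∈″)

Unique-sublists : ∀ (L : List A) → Unique L → ∀ {S} → S ∈ sublists L → Unique S
Unique-sublists [] [] (here refl) = []
Unique-sublists (x ∷ L) (x∉L ∷ uL) S∈ with ∈-++⁻ (sublists L) S∈
... | inj₁ S∈′ = Unique-sublists L uL S∈′
... | inj₂ S∈′ with ∈-map⁻ (x ∷_) S∈′
...   | S , S∈″ , refl = All.map (All.lookup x∉L) (∈-sublists⁻ L S∈″) ∷ Unique-sublists L uL S∈″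

∑-sublists-[] : ∀ (h : List A → ℕ) L → (∀ {S} → S ∈ sublists L → S ≢ [] → h S ≡ 0) →
  ∑ h (sublists L) ≡ h []
∑-sublists-[] h [] _ = +-identityʳ (h [])
∑-sublists-[] h (x ∷ L) h≡0 = begin
  ∑ h (sublists (x ∷ L))
    ≡⟨ ∑-sublists-∷ h x L ⟩
  ∑ h (sublists L) + ∑ (h ∘ (x ∷_)) (sublists L)
    ≡⟨ cong₂ _+_ (∑-sublists-[] h L (h≡0 ∘ ∈-++⁺ˡ))
                 (∑-zero (sublists L) (λ S∈ → h≡0 (∈-++⁺ʳ _ (∈-map⁺ (x ∷_) S∈)) (λ ()))) ⟩
  h [] + 0
    ≡⟨ +-identityʳ (h []) ⟩
  h [] ∎
  where open ≡-Reasoning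

∑-sublists-singletons : ∀ (h : List A → ℕ) L → (∀ {S} → S ∈ sublists L → length S ≢ 1 → h S ≡ 0) →
  ∑ h (sublists L) ≡ ∑ (h ∘ [_]) L
∑-sublists-singletons h [] h≡0 = cong (_+ 0) (h≡0 (here refl) (λ ()))
∑-sublists-singletons h (x ∷ L) h≡0 = begin
  ∑ h (sublists (x ∷ L))
    ≡⟨ ∑-sublists-∷ h x L ⟩
  ∑ h (sublists L) + ∑ (h ∘ (x ∷_)) (sublists L)
    ≡⟨ cong₂ _+_ (∑-sublists-singletons h L (h≡0 ∘ ∈-++⁺ˡ))
                 (∑-sublists-[] (h ∘ (x ∷_)) L (λ S∈ S≢[] → h≡0 (∈-++⁺ʳ _ (∈-map⁺ (x ∷_) S∈)) (S≢[] ∘ length≡0))) ⟩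
  ∑ (h ∘ [_]) L + h [ x ]
    ≡⟨ +-comm _ (h [ x ]) ⟩
  ∑ (h ∘ [_]) (x ∷ L) ∎
  where
  open ≡-Reasoning
  length≡0 : ∀ {S} → length (x ∷ S) ≡ 1 → S ≡ []
  length≡0 {[]} _ = refl

∑-sublists-++ : ∀ (h : List A → ℕ) X Y →
  ∑ h (sublists (X ++ Y)) ≡ ∑ (λ S₁ → ∑ (λ S₂ → h (S₁ ++ S₂)) (sublists Y)) (sublists X)
∑-sublists-++ h [] Y = sym (+-identityʳ _)
∑-sublists-++ h (x ∷ X) Y = begin
  ∑ h (sublists (x ∷ X ++ Y))
    ≡⟨ ∑-sublists-∷ h x (X ++ Y) ⟩
  ∑ h (sublists (X ++ Y)) + ∑ (h ∘ (x ∷_)) (sublists (X ++ Y))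
    ≡⟨ cong₂ _+_ (∑-sublists-++ h X Y) (∑-sublists-++ (h ∘ (x ∷_)) X Y) ⟩
  ∑ (λ S₁ → ∑ (λ S₂ → h (S₁ ++ S₂)) (sublists Y)) (sublists X)
    + ∑ (λ S₁ → ∑ (λ S₂ → h (x ∷ S₁ ++ S₂)) (sublists Y)) (sublists X)
    ≡⟨ ∑-sublists-∷ (λ S₁ → ∑ (λ S₂ → h (S₁ ++ S₂)) (sublists Y)) x X ⟨
  ∑ (λ S₁ → ∑ (λ S₂ → h (S₁ ++ S₂)) (sublists Y)) (sublists (x ∷ X)) ∎
  where open ≡-Reasoning

module Counting {A : Set} (_≟_ : DecidableEquality A) where

  open DecMembership _≟_ using (_∈?_)

  filterᵇ-≟-Unique : ∀ {x} xs → Unique xs → x ∈ xs → filterᵇ (λ y → does (y ≟ x)) xs ≡ [ x ]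
  filterᵇ-≟-Unique (x ∷ xs) (x∉xs ∷ _) (here refl) with x ≟ x
  ... | yes _ = cong (x ∷_) (filter-none (T? ∘ (λ y → does (y ≟ x))) (All.map ≢⇒¬T x∉xs))
    where
    ≢⇒¬T : ∀ {z} → x ≢ z → ¬ T (does (z ≟ x))
    ≢⇒¬T {z} x≢z with z ≟ x
    ... | yes z≡x = λ _ → x≢z (sym z≡x)
    ... | no _ = λ ()
  ... | no x≢x = contradiction refl x≢x
  filterᵇ-≟-Unique {x} (y ∷ xs) (y∉xs ∷ u) (there x∈) with y ≟ x
  ... | yes refl = contradiction x∈ (All¬⇒¬Any y∉xs)
  ... | no _ = filterᵇ-≟-Unique xs u x∈

  ∑-≟ : ∀ {x} L → Unique L → x ∈ L → ∑ (λ y → 𝟙 (does (y ≟ x))) L ≡ 1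
  ∑-≟ {x} L uL x∈L = trans (∑-single L uL x∈L (λ {y} _ y≢x → cong 𝟙 (dec-false (y ≟ x) y≢x)))
                           (cong 𝟙 (dec-true (x ≟ x) refl))

  ∑-minus-one : ∀ (X : A → Bool) {x} L → Unique L → x ∈ L →
    ∑ (λ y → 𝟙 (X y ∧ not (does (y ≟ x)))) L + 𝟙 (X x) ≡ ∑ (𝟙 ∘ X) L
  ∑-minus-one X {x} L uL x∈L = begin
    ∑ (λ y → 𝟙 (X y ∧ not (does (y ≟ x)))) L + 𝟙 (X x)
      ≡⟨ cong (∑ (λ y → 𝟙 (X y ∧ not (does (y ≟ x)))) L +_) (sym ∑-at-x) ⟩
    ∑ (λ y → 𝟙 (X y ∧ not (does (y ≟ x)))) L + ∑ (λ y → 𝟙 (X y ∧ does (y ≟ x))) L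
      ≡⟨ ∑-+ (λ y → 𝟙 (X y ∧ not (does (y ≟ x)))) (λ y → 𝟙 (X y ∧ does (y ≟ x))) L ⟨
    ∑ (λ y → 𝟙 (X y ∧ not (does (y ≟ x))) + 𝟙 (X y ∧ does (y ≟ x))) L
      ≡⟨ ∑-cong L (λ {y} _ → sym (𝟙-split (X y) (does (y ≟ x)))) ⟩
    ∑ (𝟙 ∘ X) L ∎
    where
    open ≡-Reasoning
    ∑-at-x : ∑ (λ y → 𝟙 (X y ∧ does (y ≟ x))) L ≡ 𝟙 (X x)
    ∑-at-x = trans (∑-single L uL x∈L (λ {y} _ y≢x →
                      cong 𝟙 (trans (cong (X y ∧_) (dec-false (y ≟ x) y≢x)) (∧-zeroʳ (X y)))))
                   (cong 𝟙 (trans (cong (X x ∧_) (dec-true (x ≟ x) refl)) (∧-identityʳ (X x))))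

  ∑-∈? : ∀ {S} L → Unique S → Unique L → All (_∈ L) S → ∑ (λ y → 𝟙 (does (y ∈? S))) L ≡ length S
  ∑-∈? {S} L uS uL S⊆L = begin
    ∑ (λ y → 𝟙 (does (y ∈? S))) L                  ≡⟨ ∑-cong L (λ {y} _ → 𝟙-∈? y) ⟩
    ∑ (λ y → ∑ (λ s → 𝟙 (does (y ≟ s))) S) L       ≡⟨ ∑-comm (λ y s → 𝟙 (does (y ≟ s))) L S ⟩
    ∑ (λ s → ∑ (λ y → 𝟙 (does (y ≟ s))) L) S       ≡⟨ ∑-cong S (λ s∈ → ∑-≟ L uL (All.lookup S⊆L s∈)) ⟩
    ∑ (λ _ → 1) S                                  ≡⟨ length≡∑1 S ⟨
    length S                                       ∎
    where
    open ≡-Reasoning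
    𝟙-∈? : ∀ y → 𝟙 (does (y ∈? S)) ≡ ∑ (λ s → 𝟙 (does (y ≟ s))) S
    𝟙-∈? y with y ∈? S
    ... | yes y∈S = sym (trans (∑-single S uS y∈S (λ {s} _ s≢y → cong 𝟙 (dec-false (y ≟ s) (s≢y ∘ sym))))
                               (cong 𝟙 (dec-true (y ≟ y) refl)))
    ... | no y∉S = sym (∑-zero S (λ {s} s∈ → cong 𝟙 (dec-false (y ≟ s) (λ { refl → y∉S s∈ }))))

  _⊆ᵇ_ : List A → List A → Bool
  S ⊆ᵇ G = all (λ f → does (f ∈? G)) S

  ∑-sublists-⊆ᵇ : ∀ G R → Unique (G ++ R) → (h : List A → ℕ) →
    ∑ (λ S → h S * 𝟙 (S ⊆ᵇ G)) (sublists (G ++ R)) ≡ ∑ h (sublists G)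
  ∑-sublists-⊆ᵇ [] R _ h = begin
    ∑ (λ S → h S * 𝟙 (S ⊆ᵇ [])) (sublists R)
      ≡⟨ ∑-sublists-[] (λ S → h S * 𝟙 (S ⊆ᵇ [])) R (λ {S} _ → nonempty S) ⟩
    h [] * 1
      ≡⟨ *-identityʳ (h []) ⟩
    h []
      ≡⟨ +-identityʳ (h []) ⟨
    ∑ h (sublists []) ∎
    where
    open ≡-Reasoning
    nonempty : ∀ S → S ≢ [] → h S * 𝟙 (S ⊆ᵇ []) ≡ 0
    nonempty [] S≢[] = contradiction refl S≢[]
    nonempty (f ∷ S) _ = *-zeroʳ (h (f ∷ S))
  ∑-sublists-⊆ᵇ (g ∷ G) R (g∉ ∷ u) h = begin
    ∑ (λ S → h S * 𝟙 (S ⊆ᵇ (g ∷ G))) (sublists (g ∷ G ++ R))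
      ≡⟨ ∑-sublists-∷ (λ S → h S * 𝟙 (S ⊆ᵇ (g ∷ G))) g (G ++ R) ⟩
    ∑ (λ S → h S * 𝟙 (S ⊆ᵇ (g ∷ G))) (sublists (G ++ R))
      + ∑ (λ S → h (g ∷ S) * 𝟙 ((g ∷ S) ⊆ᵇ (g ∷ G))) (sublists (G ++ R))
      ≡⟨ cong₂ _+_ (∑-cong (sublists (G ++ R)) (λ {S} S∈ → cong (λ b → h S * 𝟙 b) (drop-g S∈)))
                   (∑-cong (sublists (G ++ R)) (λ {S} S∈ → cong (λ b → h (g ∷ S) * 𝟙 b)
                      (trans (cong (_∧ S ⊆ᵇ (g ∷ G)) (dec-true (g ∈? (g ∷ G)) (here refl))) (drop-g S∈)))) ⟩
    ∑ (λ S → h S * 𝟙 (S ⊆ᵇ G)) (sublists (G ++ R)) + ∑ (λ S → h (g ∷ S) * 𝟙 (S ⊆ᵇ G)) (sublists (G ++ R))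
      ≡⟨ cong₂ _+_ (∑-sublists-⊆ᵇ G R u h) (∑-sublists-⊆ᵇ G R u (h ∘ (g ∷_))) ⟩
    ∑ h (sublists G) + ∑ (h ∘ (g ∷_)) (sublists G)
      ≡⟨ ∑-sublists-∷ h g G ⟨
    ∑ h (sublists (g ∷ G)) ∎
    where
    open ≡-Reasoning
    drop-g : ∀ {S} → S ∈ sublists (G ++ R) → S ⊆ᵇ (g ∷ G) ≡ S ⊆ᵇ G
    drop-g {S} S∈ = all-cong S (λ f∈ → does-⇔ (mk⇔ (tail (f≢g f∈)) there) (_ ∈? (g ∷ G)) (_ ∈? G))
      where
      f≢g : ∀ {f} → f ∈ S → f ≢ g
      f≢g f∈ refl = All.lookup g∉ (All.lookup (∈-sublists⁻ (G ++ R) S∈) f∈) refl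

-- The relative order of a pivot

module Pivot {A : Set} (_≟_ : DecidableEquality A) where

  open Counting _≟_ using (filterᵇ-≟-Unique)

  before : A → List A → List A
  before x [] = []
  before x (y ∷ ys) with x ≟ y
  ... | yes _ = []
  ... | no _ = y ∷ before x ys

  after : A → List A → List A
  after x [] = []
  after x (y ∷ ys) with x ≟ y
  ... | yes _ = ys
  ... | no _ = after x ys

  before-after : ∀ {x} ω → x ∈ ω → before x ω ++ x ∷ after x ω ≡ ω
  before-after {x} (y ∷ ys) x∈ with x ≟ y
  ... | yes refl = refl
  ... | no x≢y = cong (y ∷_) (before-after ys (tail x≢y x∈))

  ∉-before : ∀ {x} ω → x ∉ before x ω
  ∉-before {x} (y ∷ ys) x∈ with x ≟ y | x∈
  ... | no x≢y | here x≡y = x≢y x≡y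
  ... | no _ | there x∈′ = ∉-before ys x∈′

  before-++-∷ : ∀ {x} α β → x ∉ α → before x (α ++ x ∷ β) ≡ α
  before-++-∷ {x} [] β _ with x ≟ x
  ... | yes _ = refl
  ... | no x≢x = contradiction refl x≢x
  before-++-∷ {x} (a ∷ α) β x∉ with x ≟ a
  ... | yes x≡a = contradiction (here x≡a) x∉
  ... | no _ = cong (a ∷_) (before-++-∷ α β (x∉ ∘ there))

  after-++-∷ : ∀ {x} α β → x ∉ α → after x (α ++ x ∷ β) ≡ β
  after-++-∷ {x} [] β _ with x ≟ x
  ... | yes _ = refl
  ... | no x≢x = contradiction refl x≢x
  after-++-∷ {x} (a ∷ α) β x∉ with x ≟ a
  ... | yes x≡a = contradiction (here x≡a) x∉
  ... | no _ = after-++-∷ α β (x∉ ∘ there)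

  before-++ : ∀ {x} α β → x ∈ α → before x (α ++ β) ≡ before x α
  before-++ {x} (a ∷ α) β x∈ with x ≟ a
  ... | yes _ = refl
  ... | no x≢a = cong (a ∷_) (before-++ α β (tail x≢a x∈))

  after-++ : ∀ {x} α β → x ∈ α → after x (α ++ β) ≡ after x α ++ β
  after-++ {x} (a ∷ α) β x∈ with x ≟ a
  ... | yes _ = refl
  ... | no x≢a = after-++ α β (tail x≢a x∈)

  module Separation (p q : A → Bool) (x : A) where

    separated : List A → List A → Bool
    separated α β = all (not ∘ q) α ∧ all (not ∘ p) β

    separates : List A → Bool
    separates ω = separated (before x ω) (after x ω)

    -- Inserting y into a separated ordering multiplies its weight by the number of admissible slots for y,
    -- a function of the positions of x; generalising over F absorbs that factor, so that the counts below
    -- need no invariant on where x sits.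
    weighted : (ℕ → ℕ → ℕ) → List A → ℕ
    weighted F ω = 𝟙 (separates ω) * F (length (before x ω)) (length (after x ω))

    weighted-split : ∀ F α β → x ∉ α → weighted F (α ++ x ∷ β) ≡ 𝟙 (separated α β) * F (length α) (length β)
    weighted-split F α β x∉ =
      cong₂ (λ α′ β′ → 𝟙 (separated α′ β′) * F (length α′) (length β′))
            (before-++-∷ α β x∉) (after-++-∷ α β x∉)

    module _ (F : ℕ → ℕ → ℕ) {y} (y≢x : y ≢ x) {α} (x∉α : x ∉ α) (β : List A) where

      weighted-insert-before : ∀ {α′} → α′ ∈ insertions y α →
        weighted F (α′ ++ x ∷ β) ≡ 𝟙 (not (q y)) * (𝟙 (separated α β) * F (suc (length α)) (length β))
      weighted-insert-before {α′} α′∈ = begin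
        weighted F (α′ ++ x ∷ β)
          ≡⟨ weighted-split F α′ β (∉-insertions (y≢x ∘ sym) x∉α α′∈) ⟩
        𝟙 (all (not ∘ q) α′ ∧ all (not ∘ p) β) * F (length α′) (length β)
          ≡⟨ cong₂ (λ b l → 𝟙 (b ∧ all (not ∘ p) β) * F l (length β))
                   (all-insertions (not ∘ q) α′∈) (length-∈-insertions α′∈) ⟩
        𝟙 ((not (q y) ∧ all (not ∘ q) α) ∧ all (not ∘ p) β) * F (suc (length α)) (length β)
          ≡⟨ cong (λ b → 𝟙 b * F (suc (length α)) (length β)) (∧-assoc (not (q y)) _ _) ⟩
        𝟙 (not (q y) ∧ separated α β) * F (suc (length α)) (length β)
          ≡⟨ trans (cong (_* _) (𝟙-∧ (not (q y)) (separated α β))) (*-assoc (𝟙 (not (q y))) (𝟙 (separated α β)) _) ⟩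
        𝟙 (not (q y)) * (𝟙 (separated α β) * F (suc (length α)) (length β)) ∎
        where open ≡-Reasoning

      weighted-insert-after : ∀ {β′} → β′ ∈ insertions y β →
        weighted F (α ++ x ∷ β′) ≡ 𝟙 (not (p y)) * (𝟙 (separated α β) * F (length α) (suc (length β)))
      weighted-insert-after {β′} β′∈ = begin
        weighted F (α ++ x ∷ β′)
          ≡⟨ weighted-split F α β′ x∉α ⟩
        𝟙 (all (not ∘ q) α ∧ all (not ∘ p) β′) * F (length α) (length β′)
          ≡⟨ cong₂ (λ b l → 𝟙 (all (not ∘ q) α ∧ b) * F (length α) l)
                   (all-insertions (not ∘ p) β′∈) (length-∈-insertions β′∈) ⟩
        𝟙 (all (not ∘ q) α ∧ (not (p y) ∧ all (not ∘ p) β)) * F (length α) (suc (length β))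
          ≡⟨ cong (λ b → 𝟙 b * F (length α) (suc (length β))) (∧-left-comm (all (not ∘ q) α) (not (p y)) _) ⟩
        𝟙 (not (p y) ∧ separated α β) * F (length α) (suc (length β))
          ≡⟨ trans (cong (_* _) (𝟙-∧ (not (p y)) (separated α β))) (*-assoc (𝟙 (not (p y))) (𝟙 (separated α β)) _) ⟩
        𝟙 (not (p y)) * (𝟙 (separated α β) * F (length α) (suc (length β))) ∎
        where open ≡-Reasoning

      ∑-weighted-insertions-split :
        ∑ (weighted F) (insertions y (α ++ x ∷ β)) ≡
          𝟙 (not (q y)) * weighted (λ a b → suc a * F (suc a) b) (α ++ x ∷ β)
          + 𝟙 (not (p y)) * weighted (λ a b → suc b * F a (suc b)) (α ++ x ∷ β)
      ∑-weighted-insertions-split = begin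
        ∑ (weighted F) (insertions y (α ++ x ∷ β))
          ≡⟨ cong (∑ (weighted F)) (insertions-++ y α x β) ⟩
        ∑ (weighted F) (map (_++ x ∷ β) (insertions y α) ++ map (λ β′ → α ++ x ∷ β′) (insertions y β))
          ≡⟨ ∑-++ (weighted F) (map (_++ x ∷ β) (insertions y α)) _ ⟩
        ∑ (weighted F) (map (_++ x ∷ β) (insertions y α))
          + ∑ (weighted F) (map (λ β′ → α ++ x ∷ β′) (insertions y β))
          ≡⟨ cong₂ _+_ (∑-map (weighted F) (_++ x ∷ β) (insertions y α))
                       (∑-map (weighted F) (λ β′ → α ++ x ∷ β′) (insertions y β)) ⟩
        ∑ (λ α′ → weighted F (α′ ++ x ∷ β)) (insertions y α)
          + ∑ (λ β′ → weighted F (α ++ x ∷ β′)) (insertions y β)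
          ≡⟨ cong₂ _+_ (trans (∑-cong (insertions y α) weighted-insert-before) (∑-const _ (insertions y α)))
                       (trans (∑-cong (insertions y β) weighted-insert-after) (∑-const _ (insertions y β))) ⟩
        length (insertions y α) * (𝟙 (not (q y)) * (𝟙 s * F (suc (length α)) (length β)))
          + length (insertions y β) * (𝟙 (not (p y)) * (𝟙 s * F (length α) (suc (length β))))
          ≡⟨ cong₂ _+_ (scale α (𝟙 (not (q y))) (F (suc (length α)) (length β)))
                       (scale β (𝟙 (not (p y))) (F (length α) (suc (length β)))) ⟩
        𝟙 (not (q y)) * (𝟙 s * (suc (length α) * F (suc (length α)) (length β)))
          + 𝟙 (not (p y)) * (𝟙 s * (suc (length β) * F (length α) (suc (length β))))
          ≡⟨ cong₂ _+_ (cong (𝟙 (not (q y)) *_) (sym (weighted-split (λ a b → suc a * F (suc a) b) α β x∉α)))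
                       (cong (𝟙 (not (p y)) *_) (sym (weighted-split (λ a b → suc b * F a (suc b)) α β x∉α))) ⟩
        𝟙 (not (q y)) * weighted (λ a b → suc a * F (suc a) b) (α ++ x ∷ β)
          + 𝟙 (not (p y)) * weighted (λ a b → suc b * F a (suc b)) (α ++ x ∷ β) ∎
        where
        open ≡-Reasoning
        s : Bool
        s = separated α β
        regroup : ∀ k c t u → k * (c * (t * u)) ≡ c * (t * (k * u))
        regroup = solve-∀
        scale : ∀ γ c u → length (insertions y γ) * (c * (𝟙 s * u)) ≡ c * (𝟙 s * (suc (length γ) * u))
        scale γ c u = trans (cong (_* (c * (𝟙 s * u))) (length-insertions y γ)) (regroup (suc (length γ)) c (𝟙 s) u)

    ∑-weighted-insertions : ∀ F y {ω} → y ≢ x → x ∈ ω →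
      ∑ (weighted F) (insertions y ω) ≡
        𝟙 (not (q y)) * weighted (λ a b → suc a * F (suc a) b) ω
        + 𝟙 (not (p y)) * weighted (λ a b → suc b * F a (suc b)) ω
    ∑-weighted-insertions F y {ω} y≢x x∈ =
      subst (λ ω → ∑ (weighted F) (insertions y ω) ≡
                     𝟙 (not (q y)) * weighted (λ a b → suc a * F (suc a) b) ω
                     + 𝟙 (not (p y)) * weighted (λ a b → suc b * F a (suc b)) ω)
            (before-after ω x∈) (∑-weighted-insertions-split F y≢x (∉-before ω) (after x ω))

    Early Late Free : A → Set
    Early y = p y ≡ true × q y ≡ false × y ≢ x
    Late y = p y ≡ false × q y ≡ true × y ≢ x
    Free y = p y ≡ false × q y ≡ false × y ≢ x

    ∑-weighted-early : ∀ Es → All Early Es → ∀ F →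
      ∑ (weighted F) (permutations (Es ++ [ x ])) ≡ length Es ! * F (length Es) 0
    ∑-weighted-early [] [] F = trans (+-identityʳ _) (weighted-split F [] [] (λ ()))
    ∑-weighted-early (y ∷ Es) ((py , qy , y≢x) ∷ early) F = begin
      ∑ (weighted F) (permutations (y ∷ Es ++ [ x ]))
        ≡⟨ ∑-concatMap (weighted F) (insertions y) (permutations (Es ++ [ x ])) ⟩
      ∑ (∑ (weighted F) ∘ insertions y) (permutations (Es ++ [ x ]))
        ≡⟨ ∑-cong (permutations (Es ++ [ x ])) (λ {π} π∈ →
             trans (∑-weighted-insertions F y y≢x (∈-permutations (Es ++ [ x ]) π∈ (∈-++⁺ʳ Es (here refl))))
                   (only-first _ _)) ⟩
      ∑ (weighted (λ a b → suc a * F (suc a) b)) (permutations (Es ++ [ x ]))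
        ≡⟨ ∑-weighted-early Es early (λ a b → suc a * F (suc a) b) ⟩
      length Es ! * (suc (length Es) * F (suc (length Es)) 0)
        ≡⟨ regroup (length Es !) (suc (length Es)) (F (suc (length Es)) 0) ⟩
      suc (length Es) ! * F (suc (length Es)) 0 ∎
      where
      open ≡-Reasoning
      only-first : ∀ u v → 𝟙 (not (q y)) * u + 𝟙 (not (p y)) * v ≡ u
      only-first u v rewrite py | qy = trans (+-identityʳ _) (*-identityˡ u)
      regroup : ∀ f s g → f * (s * g) ≡ s * f * g
      regroup = solve-∀

    ∑-weighted-late : ∀ Ls Es → All Late Ls → All Early Es → ∀ F →
      ∑ (weighted F) (permutations (Ls ++ Es ++ [ x ])) ≡ length Ls ! * (length Es ! * F (length Es) (length Ls))
    ∑-weighted-late [] Es [] early F = trans (∑-weighted-early Es early F) (sym (+-identityʳ _))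
    ∑-weighted-late (y ∷ Ls) Es ((py , qy , y≢x) ∷ late) early F = begin
      ∑ (weighted F) (permutations (y ∷ Ls ++ Es ++ [ x ]))
        ≡⟨ ∑-concatMap (weighted F) (insertions y) (permutations (Ls ++ Es ++ [ x ])) ⟩
      ∑ (∑ (weighted F) ∘ insertions y) (permutations (Ls ++ Es ++ [ x ]))
        ≡⟨ ∑-cong (permutations (Ls ++ Es ++ [ x ])) (λ {π} π∈ →
             trans (∑-weighted-insertions F y y≢x (∈-permutations (Ls ++ Es ++ [ x ]) π∈ x∈)) (only-second _ _)) ⟩
      ∑ (weighted (λ a b → suc b * F a (suc b))) (permutations (Ls ++ Es ++ [ x ]))
        ≡⟨ ∑-weighted-late Ls Es late early (λ a b → suc b * F a (suc b)) ⟩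
      length Ls ! * (length Es ! * (suc (length Ls) * F (length Es) (suc (length Ls))))
        ≡⟨ regroup (length Ls !) (length Es !) (suc (length Ls)) (F (length Es) (suc (length Ls))) ⟩
      suc (length Ls) ! * (length Es ! * F (length Es) (suc (length Ls))) ∎
      where
      open ≡-Reasoning
      x∈ : x ∈ Ls ++ Es ++ [ x ]
      x∈ = ∈-++⁺ʳ Ls (∈-++⁺ʳ Es (here refl))
      only-second : ∀ u v → 𝟙 (not (q y)) * u + 𝟙 (not (p y)) * v ≡ v
      only-second u v rewrite py | qy = *-identityˡ v
      regroup : ∀ f e s g → f * (e * (s * g)) ≡ s * f * (e * g)
      regroup = solve-∀

    private
      length-split : ∀ ω → x ∈ ω → length ω ≡ length (before x ω) + suc (length (after x ω))
      length-split ω x∈ = trans (cong length (sym (before-after ω x∈))) (length-++ (before x ω))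

    ∑-weighted-insertions-free : ∀ y {ω} → Free y → x ∈ ω →
      ∑ (weighted (λ _ _ → 1)) (insertions y ω) ≡ suc (length ω) * weighted (λ _ _ → 1) ω
    ∑-weighted-insertions-free y {ω} (py , qy , y≢x) x∈ = begin
      ∑ (weighted (λ _ _ → 1)) (insertions y ω)
        ≡⟨ ∑-weighted-insertions (λ _ _ → 1) y y≢x x∈ ⟩
      𝟙 (not (q y)) * weighted (λ a _ → suc a * 1) ω + 𝟙 (not (p y)) * weighted (λ _ b → suc b * 1) ω
        ≡⟨ both (weighted (λ a _ → suc a * 1) ω) (weighted (λ _ b → suc b * 1) ω) ⟩
      𝟙 (separates ω) * (suc (length (before x ω)) * 1) + 𝟙 (separates ω) * (suc (length (after x ω)) * 1)
        ≡⟨ regroup (𝟙 (separates ω)) (length (before x ω)) (length (after x ω)) ⟩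
      suc (length (before x ω) + suc (length (after x ω))) * weighted (λ _ _ → 1) ω
        ≡⟨ cong (λ l → suc l * weighted (λ _ _ → 1) ω) (sym (length-split ω x∈)) ⟩
      suc (length ω) * weighted (λ _ _ → 1) ω ∎
      where
      open ≡-Reasoning
      both : ∀ u v → 𝟙 (not (q y)) * u + 𝟙 (not (p y)) * v ≡ u + v
      both u v rewrite py | qy = cong₂ _+_ (*-identityˡ u) (*-identityˡ v)
      regroup : ∀ t a b → t * (suc a * 1) + t * (suc b * 1) ≡ suc (a + suc b) * (t * 1)
      regroup = solve-∀

    ∑-weighted-free : ∀ Ns R → x ∈ R → All Free Ns →
      ∑ (weighted (λ _ _ → 1)) (permutations (Ns ++ R)) * length R !
        ≡ length (Ns ++ R) ! * ∑ (weighted (λ _ _ → 1)) (permutations R)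
    ∑-weighted-free [] R x∈R [] = *-comm _ (length R !)
    ∑-weighted-free (y ∷ Ns) R x∈R (free ∷ frees) = begin
      ∑ (weighted (λ _ _ → 1)) (permutations (y ∷ Ns ++ R)) * length R !
        ≡⟨ cong (_* length R !) (∑-permutations-∷ (weighted (λ _ _ → 1)) (suc (length (Ns ++ R))) y (Ns ++ R) insert-y) ⟩
      suc (length (Ns ++ R)) * ∑ (weighted (λ _ _ → 1)) (permutations (Ns ++ R)) * length R !
        ≡⟨ *-assoc (suc (length (Ns ++ R))) (∑ (weighted (λ _ _ → 1)) (permutations (Ns ++ R))) (length R !) ⟩
      suc (length (Ns ++ R)) * (∑ (weighted (λ _ _ → 1)) (permutations (Ns ++ R)) * length R !)
        ≡⟨ cong (suc (length (Ns ++ R)) *_) (∑-weighted-free Ns R x∈R frees) ⟩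
      suc (length (Ns ++ R)) * (length (Ns ++ R) ! * ∑ (weighted (λ _ _ → 1)) (permutations R))
        ≡⟨ *-assoc (suc (length (Ns ++ R))) (length (Ns ++ R) !) _ ⟨
      suc (length (Ns ++ R)) ! * ∑ (weighted (λ _ _ → 1)) (permutations R) ∎
      where
      open ≡-Reasoning
      insert-y : ∀ {π} → π ∈ permutations (Ns ++ R) →
        ∑ (weighted (λ _ _ → 1)) (insertions y π) ≡ suc (length (Ns ++ R)) * weighted (λ _ _ → 1) π
      insert-y {π} π∈ =
        trans (∑-weighted-insertions-free y free (∈-permutations (Ns ++ R) π∈ (∈-++⁺ʳ Ns x∈R)))
              (cong (λ l → suc l * weighted (λ _ _ → 1) π) (↭-length (↭-permutations (Ns ++ R) π∈)))

    ∑-separates : ∀ {L} Ns Ls Es → L ↭ Ns ++ Ls ++ Es ++ [ x ] → All Free Ns → All Late Ls → All Early Es →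
      ∑ (𝟙 ∘ separates) (permutations L) * suc (length Es + length Ls) ! ≡ length L ! * (length Es ! * length Ls !)
    ∑-separates {L} Ns Ls Es L↭ free late early = begin
      ∑ (𝟙 ∘ separates) (permutations L) * suc (length Es + length Ls) !
        ≡⟨ cong₂ _*_ (trans (∑-cong (permutations L) (λ {ω} _ → sym (*-identityʳ (𝟙 (separates ω)))))
                            (∑-permutations-↭ (weighted (λ _ _ → 1)) L↭))
                     (cong _! (sym length-R)) ⟩
      ∑ (weighted (λ _ _ → 1)) (permutations (Ns ++ R)) * length R !
        ≡⟨ ∑-weighted-free Ns R (∈-++⁺ʳ Ls (∈-++⁺ʳ Es (here refl))) free ⟩
      length (Ns ++ R) ! * ∑ (weighted (λ _ _ → 1)) (permutations R)
        ≡⟨ cong₂ (λ l s → l ! * s) (sym (↭-length L↭)) (∑-weighted-late Ls Es late early (λ _ _ → 1)) ⟩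
      length L ! * (length Ls ! * (length Es ! * 1))
        ≡⟨ cong (length L ! *_) (regroup (length Ls !) (length Es !)) ⟩
      length L ! * (length Es ! * length Ls !) ∎
      where
      open ≡-Reasoning
      R : List A
      R = Ls ++ Es ++ [ x ]
      length-R : length R ≡ suc (length Es + length Ls)
      length-R = trans (length-++ Ls)
        (trans (cong (length Ls +_) (trans (length-++ Es) (+-comm (length Es) 1)))
               (trans (+-suc (length Ls) (length Es)) (cong suc (+-comm (length Ls) (length Es)))))
      regroup : ∀ a b → a * (b * 1) ≡ b * a
      regroup = solve-∀

    private
      pivot? free? : A → Bool
      pivot? y = does (y ≟ x)
      free? y = not (p y) ∧ (not (q y) ∧ not (pivot? y))

      ∷-↭-++ : ∀ (y : A) xs ys → y ∷ xs ++ ys ↭ xs ++ y ∷ ys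
      ∷-↭-++ y xs ys = ↭-sym (shift y xs ys)

      ∷-↭-second : ∀ y (N Lt R : List A) → y ∷ N ++ Lt ++ R ↭ N ++ Lt ++ y ∷ R
      ∷-↭-second y N Lt R = ↭-trans (∷-↭-++ y N (Lt ++ R)) (++⁺ˡ N (∷-↭-++ y Lt R))

      ∷-↭-third : ∀ y (N Lt Er R : List A) → y ∷ N ++ Lt ++ Er ++ R ↭ N ++ Lt ++ Er ++ y ∷ R
      ∷-↭-third y N Lt Er R = ↭-trans (∷-↭-++ y N (Lt ++ Er ++ R)) (++⁺ˡ N (∷-↭-second y Lt Er R))

    module _ (p⇒¬q : ∀ y → p y ≡ true → q y ≡ false) (px : p x ≡ false) (qx : q x ≡ false) where

      private
        partition-by-role : ∀ l → l ↭ filterᵇ free? l ++ filterᵇ q l ++ filterᵇ p l ++ filterᵇ pivot? l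
        partition-by-role [] = ↭-refl
        partition-by-role (y ∷ l) with p y in py | q y in qy | y ≟ x
        ... | true | true | _ = contradiction (trans (sym (p⇒¬q y py)) qy) λ ()
        ... | true | false | yes refl = contradiction (trans (sym px) py) λ ()
        ... | false | true | yes refl = contradiction (trans (sym qx) qy) λ ()
        ... | false | false | yes refl = ↭-trans (↭.prep y (partition-by-role l))
          (∷-↭-third y (filterᵇ free? l) (filterᵇ q l) (filterᵇ p l) (filterᵇ pivot? l))
        ... | true | false | no _ = ↭-trans (↭.prep y (partition-by-role l))
          (∷-↭-second y (filterᵇ free? l) (filterᵇ q l) (filterᵇ p l ++ filterᵇ pivot? l))
        ... | false | true | no _ = ↭-trans (↭.prep y (partition-by-role l))
          (∷-↭-++ y (filterᵇ free? l) (filterᵇ q l ++ filterᵇ p l ++ filterᵇ pivot? l))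
        ... | false | false | no _ = ↭.prep y (partition-by-role l)

        free-role : ∀ y → free? y ≡ true → Free y
        free-role y fy with p y | q y | y ≟ x
        ... | false | false | no y≢x = refl , refl , y≢x

        late-role : ∀ y → q y ≡ true → Late y
        late-role y qy with p y in py
        ... | true = contradiction (trans (sym (p⇒¬q y py)) qy) λ ()
        ... | false = refl , qy , λ { refl → contradiction (trans (sym qx) qy) λ () }

        early-role : ∀ y → p y ≡ true → Early y
        early-role y py = py , p⇒¬q y py , λ { refl → contradiction (trans (sym px) py) λ () }

      ∑-separates-count : ∀ L → Unique L → x ∈ L →
        ∑ (𝟙 ∘ separates) (permutations L) * suc (∑ (𝟙 ∘ p) L + ∑ (𝟙 ∘ q) L) !
          ≡ length L ! * (∑ (𝟙 ∘ p) L ! * ∑ (𝟙 ∘ q) L !)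
      ∑-separates-count L uL x∈L =
        subst₂ (λ a b → ∑ (𝟙 ∘ separates) (permutations L) * suc (a + b) ! ≡ length L ! * (a ! * b !))
               (length-filter (T? ∘ p) L) (length-filter (T? ∘ q) L)
               (∑-separates (filterᵇ free? L) (filterᵇ q L) (filterᵇ p L) L↭
                  (All.map (free-role _) (All-filterᵇ free? L))
                  (All.map (late-role _) (All-filterᵇ q L))
                  (All.map (early-role _) (All-filterᵇ p L)))
        where
        L↭ : L ↭ filterᵇ free? L ++ filterᵇ q L ++ filterᵇ p L ++ [ x ]
        L↭ = subst (λ X → L ↭ filterᵇ free? L ++ filterᵇ q L ++ filterᵇ p L ++ X)
                   (filterᵇ-≟-Unique L uL x∈L) (partition-by-role L)

-- The stopped graph

firstSat-map : ∀ {P : List A → Set} (P? : Decidable P) (f : B → List A) d xs →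
  firstSat P? (f d) (map f xs) ≡ f (firstSat (P? ∘ f) d xs)
firstSat-map P? f d [] = refl
firstSat-map P? f d (x ∷ xs) with P? (f x)
... | yes _ = refl
... | no _ = firstSat-map P? f d xs

firstSat-inits-++ : ∀ {P : List A → Set} (P? : Decidable P) ω → ∃ λ R → firstSat P? ω (inits ω) ++ R ≡ ω
firstSat-inits-++ P? [] with P? []
... | yes _ = [] , refl
... | no _ = [] , refl
firstSat-inits-++ P? (y ∷ ys) with P? []
... | yes _ = y ∷ ys , refl
... | no _ rewrite firstSat-map P? (y ∷_) ys (inits ys) with firstSat-inits-++ (P? ∘ (y ∷_)) ys
...   | R , G++R≡ys = R , cong (y ∷_) G++R≡ys

module Stopping {A : Set} (_≟_ : DecidableEquality A) where

  open Pivot _≟_ using (before)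

  ∈-firstSat-inits : ∀ {P : List A → Set} (P? : Decidable P) → (∀ l r → P l → P (l ++ r)) →
    ∀ ω {x} → x ∈ ω → (x ∈ firstSat P? ω (inits ω)) ⇔ (¬ P (before x ω))
  ∈-firstSat-inits {P} P? P-++ (y ∷ ys) {x} x∈ with P? []
  ... | yes P[] = mk⇔ (λ ()) (λ ¬P → contradiction (P-++ [] (before x (y ∷ ys)) P[]) ¬P)
  ... | no ¬P[] rewrite firstSat-map P? (y ∷_) ys (inits ys) with x ≟ y
  ...   | yes refl = mk⇔ (λ _ → ¬P[]) (λ _ → here refl)
  ...   | no x≢y = mk⇔ (Equivalence.to IH ∘ tail x≢y) (there ∘ Equivalence.from IH)
    where
    IH : (x ∈ firstSat (P? ∘ (y ∷_)) ys (inits ys)) ⇔ (¬ P (y ∷ before x ys))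
    IH = ∈-firstSat-inits (P? ∘ (y ∷_)) (P-++ ∘ (y ∷_)) ys (tail x≢y x∈)

module CompleteBipartite (n : ℕ) where

  _≟E_ : DecidableEquality (Edge n)
  _≟E_ = ≡-dec _≟ᶠ_ _≟ᶠ_

  open DecMembership _≟E_ using (_∈?_)
  open Counting _≟E_

  ∈-allEdges : ∀ f → f ∈ allEdges n
  ∈-allEdges (i , j) = ∈-cartesianProduct⁺ (∈-allFin i) (∈-allFin j)

  Unique-allEdges : Unique (allEdges n)
  Unique-allEdges = cartesianProduct⁺ (allFin⁺ n) (allFin⁺ n)

  ∈-allVertices : ∀ v → v ∈ allVertices n
  ∈-allVertices (inj₁ i) = ∈-++⁺ˡ (∈-map⁺ inj₁ (∈-allFin i))
  ∈-allVertices (inj₂ j) = ∈-++⁺ʳ (map inj₁ (allFin n)) (∈-map⁺ inj₂ (∈-allFin j))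

  ∑-cartesianProduct : ∀ (h : Edge n → ℕ) is js →
    ∑ h (cartesianProduct is js) ≡ ∑ (λ i → ∑ (λ j → h (i , j)) js) is
  ∑-cartesianProduct h [] js = refl
  ∑-cartesianProduct h (i ∷ is) js =
    trans (∑-++ h (map (i ,_) js) (cartesianProduct is js)) (cong₂ _+_ (∑-map h (i ,_) js) (∑-cartesianProduct h is js))

  ∑-allFin-≟ : ∀ a → ∑ (λ i → 𝟙 (does (i ≟ᶠ a))) (allFin n) ≡ 1
  ∑-allFin-≟ a = Counting.∑-≟ _≟ᶠ_ (allFin n) (allFin⁺ n) (∈-allFin a)

  length-allFin : length (allFin n) ≡ n
  length-allFin = length-tabulate (λ i → i)

  ∑-allFin-const : ∀ k → ∑ (λ (_ : Fin n) → k) (allFin n) ≡ n * k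
  ∑-allFin-const k = trans (∑-const k (allFin n)) (cong (_* k) length-allFin)

  degree-++ : ∀ (v : Vertex n) l r → degree v (l ++ r) ≡ degree v l + degree v r
  degree-++ v l r = trans (cong length (filter-++ (incident? v) l r)) (length-++ (filter (incident? v) l))

  NoIsolated-++ : ∀ (l r : List (Edge n)) → NoIsolated l → NoIsolated (l ++ r)
  NoIsolated-++ l r = All.map (λ {v} 1≤d → ≤-trans 1≤d (≤-trans (m≤m+n _ _) (≤-reflexive (sym (degree-++ v l r)))))

  incident⇒1≤degree : ∀ (v : Vertex n) {f} l → f ∈ l → Incident v f → 1 ≤ degree v l
  incident⇒1≤degree v l f∈ vf with filter (incident? v) l | ∈-filter⁺ (incident? v) f∈ vf
  ... | _ ∷ _ | _ = s≤s z≤n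

  ¬incident⇒degree≡0 : ∀ (v : Vertex n) l → All (¬_ ∘ Incident v) l → degree v l ≡ 0
  ¬incident⇒degree≡0 v l ¬v = cong length (filter-none (incident? v) ¬v)

  module _ {S : List (Edge n)} (pm : IsPerfectMatching S) where

    matched : ∀ v → ∃ λ f → f ∈ S × Incident v f
    matched v with filter (incident? v) S in eq | All.lookup pm (∈-allVertices v)
    ... | f ∷ [] | _ = f , ∈-filter⁻ (incident? v) (subst (f ∈_) (sym eq) (here refl))

    matched-unique : ∀ v {e f} → e ∈ S → f ∈ S → Incident v e → Incident v f → e ≡ f
    matched-unique v e∈ f∈ ve vf
      with filter (incident? v) S | All.lookup pm (∈-allVertices v)
         | ∈-filter⁺ (incident? v) e∈ ve | ∈-filter⁺ (incident? v) f∈ vf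
    ... | g ∷ [] | _ | here refl | here refl = refl

    length-matching : length S ≡ n
    length-matching = begin
      length S
        ≡⟨ length≡∑1 S ⟩
      ∑ (λ _ → 1) S
        ≡⟨ ∑-cong S (λ {s} _ → sym (∑-row s)) ⟩
      ∑ (λ s → ∑ (λ i → 𝟙 (does (proj₁ s ≟ᶠ i))) (allFin n)) S
        ≡⟨ ∑-comm (λ s i → 𝟙 (does (proj₁ s ≟ᶠ i))) S (allFin n) ⟩
      ∑ (λ i → ∑ (λ s → 𝟙 (does (proj₁ s ≟ᶠ i))) S) (allFin n)
        ≡⟨ ∑-cong (allFin n) (λ {i} _ → sym (length-filter (incident? (inj₁ i)) S)) ⟩
      ∑ (λ i → degree (inj₁ i) S) (allFin n)
        ≡⟨ ∑-cong (allFin n) (λ {i} _ → All.lookup pm (∈-allVertices (inj₁ i))) ⟩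
      ∑ (λ _ → 1) (allFin n)
        ≡⟨ ∑-allFin-const 1 ⟩
      n * 1
        ≡⟨ *-identityʳ n ⟩
      n ∎
      where
      open ≡-Reasoning
      ∑-row : ∀ s → ∑ (λ i → 𝟙 (does (proj₁ s ≟ᶠ i))) (allFin n) ≡ 1
      ∑-row s = trans (∑-single (allFin n) (allFin⁺ n) (∈-allFin (proj₁ s))
                                (λ {i} _ i≢ → cong 𝟙 (dec-false (proj₁ s ≟ᶠ i) (i≢ ∘ sym))))
                      (cong 𝟙 (dec-true (proj₁ s ≟ᶠ proj₁ s) refl))

  other : List (Edge n) → Edge n → Edge n → Bool
  other S e f = does (f ∈? S) ∧ not (does (f ≟E e))

  mate : Vertex n → Edge n → Edge n → Bool
  mate v e f = does (incident? v f) ∧ not (does (f ≟E e))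

  row col : Edge n → Vertex n
  row e = inj₁ (proj₁ e)
  col e = inj₂ (proj₂ e)

  rowMate colMate mates : Edge n → Edge n → Bool
  rowMate e = mate (row e) e
  colMate e = mate (col e) e
  mates e f = rowMate e f ∨ colMate e f

  -- inOrder rowMate, inOrder colMate and inOrder mates are the events R_e, C_e and B_e of the outline.
  inOrder : (Edge n → Edge n → Bool) → List (Edge n) → Edge n → List (Edge n) → Bool
  inOrder q S e = Pivot.Separation.separates _≟E_ (other S e) (q e) e

  ∧-not-self : ∀ b e → b ∧ not (does (e ≟E e)) ≡ false
  ∧-not-self b e = trans (cong (λ c → b ∧ not c) (dec-true (e ≟E e) refl)) (∧-zeroʳ b)

  row∧col-mate : ∀ e f → mate (row e) e f ∧ mate (col e) e f ≡ false
  row∧col-mate e f with incident? (row e) f | incident? (col e) f | f ≟E e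
  ... | yes _ | yes _ | yes _ = refl
  ... | yes f₁≡ | yes f₂≡ | no f≢e = contradiction (×-≡,≡→≡ (f₁≡ , f₂≡)) f≢e
  ... | yes _ | no _ | yes _ = refl
  ... | yes _ | no _ | no _ = refl
  ... | no _ | _ | _ = refl

  count-incident : ∀ v → ∑ (λ f → 𝟙 (does (incident? v f))) (allEdges n) ≡ n
  count-incident (inj₁ a) = begin
    ∑ (λ f → 𝟙 (does (proj₁ f ≟ᶠ a))) (allEdges n)                ≡⟨ ∑-cartesianProduct _ (allFin n) (allFin n) ⟩
    ∑ (λ i → ∑ (λ _ → 𝟙 (does (i ≟ᶠ a))) (allFin n)) (allFin n)
      ≡⟨ ∑-cong (allFin n) (λ {i} _ → ∑-allFin-const (𝟙 (does (i ≟ᶠ a)))) ⟩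
    ∑ (λ i → n * 𝟙 (does (i ≟ᶠ a))) (allFin n)                    ≡⟨ ∑-*ˡ n (λ i → 𝟙 (does (i ≟ᶠ a))) (allFin n) ⟩
    n * ∑ (λ i → 𝟙 (does (i ≟ᶠ a))) (allFin n)                    ≡⟨ cong (n *_) (∑-allFin-≟ a) ⟩
    n * 1                                                         ≡⟨ *-identityʳ n ⟩
    n                                                             ∎
    where open ≡-Reasoning
  count-incident (inj₂ b) = begin
    ∑ (λ f → 𝟙 (does (proj₂ f ≟ᶠ b))) (allEdges n)                ≡⟨ ∑-cartesianProduct _ (allFin n) (allFin n) ⟩
    ∑ (λ _ → ∑ (λ j → 𝟙 (does (j ≟ᶠ b))) (allFin n)) (allFin n)   ≡⟨ ∑-cong (allFin n) (λ _ → ∑-allFin-≟ b) ⟩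
    ∑ (λ _ → 1) (allFin n)                                        ≡⟨ ∑-allFin-const 1 ⟩
    n * 1                                                         ≡⟨ *-identityʳ n ⟩
    n                                                             ∎
    where open ≡-Reasoning

  count-mate : ∀ v e → Incident v e → suc (∑ (𝟙 ∘ mate v e) (allEdges n)) ≡ n
  count-mate v e ve = begin
    suc (∑ (𝟙 ∘ mate v e) (allEdges n))                             ≡⟨ +-comm 1 _ ⟩
    ∑ (𝟙 ∘ mate v e) (allEdges n) + 1
      ≡⟨ cong (∑ (𝟙 ∘ mate v e) (allEdges n) +_) (cong 𝟙 (dec-true (incident? v e) ve)) ⟨
    ∑ (𝟙 ∘ mate v e) (allEdges n) + 𝟙 (does (incident? v e))
      ≡⟨ ∑-minus-one (λ f → does (incident? v f)) (allEdges n) Unique-allEdges (∈-allEdges e) ⟩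
    ∑ (λ f → 𝟙 (does (incident? v f))) (allEdges n)                 ≡⟨ count-incident v ⟩
    n                                                               ∎
    where open ≡-Reasoning

  count-mates : ∀ e → suc (suc (∑ (𝟙 ∘ mates e) (allEdges n))) ≡ n + n
  count-mates e = begin
    suc (suc (∑ (𝟙 ∘ mates e) (allEdges n)))
      ≡⟨ cong (suc ∘ suc) (∑-cong (allEdges n) (λ {f} _ → 𝟙-disjoint f)) ⟩
    suc (suc (∑ (λ f → 𝟙 (mate (row e) e f) + 𝟙 (mate (col e) e f)) (allEdges n)))
      ≡⟨ cong (suc ∘ suc) (∑-+ (𝟙 ∘ mate (row e) e) (𝟙 ∘ mate (col e) e) (allEdges n)) ⟩
    suc (suc (∑ (𝟙 ∘ mate (row e) e) (allEdges n) + ∑ (𝟙 ∘ mate (col e) e) (allEdges n)))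
      ≡⟨ cong suc (sym (+-suc _ _)) ⟩
    suc (∑ (𝟙 ∘ mate (row e) e) (allEdges n)) + suc (∑ (𝟙 ∘ mate (col e) e) (allEdges n))
      ≡⟨ cong₂ _+_ (count-mate (row e) e refl) (count-mate (col e) e refl) ⟩
    n + n ∎
    where
    open ≡-Reasoning
    𝟙-disjoint : ∀ f → 𝟙 (mates e f) ≡ 𝟙 (mate (row e) e f) + 𝟙 (mate (col e) e f)
    𝟙-disjoint f = trans (sym (+-identityʳ _)) (trans (cong (𝟙 (mates e f) +_) (cong 𝟙 (sym (row∧col-mate e f))))
                                                      (𝟙-∨ (mate (row e) e f) (mate (col e) e f)))

  module _ {S : List (Edge n)} (pm : IsPerfectMatching S) (uS : Unique S) {e} (e∈S : e ∈ S) where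

    count-other : suc (∑ (𝟙 ∘ other S e) (allEdges n)) ≡ n
    count-other = begin
      suc (∑ (𝟙 ∘ other S e) (allEdges n))                  ≡⟨ +-comm 1 _ ⟩
      ∑ (𝟙 ∘ other S e) (allEdges n) + 1
        ≡⟨ cong (∑ (𝟙 ∘ other S e) (allEdges n) +_) (cong 𝟙 (dec-true (e ∈? S) e∈S)) ⟨
      ∑ (𝟙 ∘ other S e) (allEdges n) + 𝟙 (does (e ∈? S))
        ≡⟨ ∑-minus-one (λ f → does (f ∈? S)) (allEdges n) Unique-allEdges (∈-allEdges e) ⟩
      ∑ (λ f → 𝟙 (does (f ∈? S))) (allEdges n)
        ≡⟨ ∑-∈? (allEdges n) uS Unique-allEdges (All.tabulate (λ {f} _ → ∈-allEdges f)) ⟩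
      length S                                              ≡⟨ length-matching {S = S} pm ⟩
      n                                                     ∎
      where open ≡-Reasoning

    other⇒¬mate : ∀ v → Incident v e → ∀ f → other S e f ≡ true → mate v e f ≡ false
    other⇒¬mate v ve f other≡ with ∧-true other≡ | incident? v f
    ... | f∈? , f≢? | yes vf = contradiction (matched-unique {S = S} pm v (does-true (f ∈? S) f∈?) e∈S vf ve)
                                             (does-false (f ≟E e) (not-true f≢?))
    ... | _ | no _ = refl

    other⇒¬mates : ∀ f → other S e f ≡ true → mates e f ≡ false
    other⇒¬mates f other≡ = cong₂ _∨_ (other⇒¬mate (row e) refl f other≡) (other⇒¬mate (col e) refl f other≡)

-- The last edge of a perfect matching

module LastMatchingEdge (n : ℕ) where
  open CompleteBipartite n
  open Pivot _≟E_
  open Counting _≟E_ using (_⊆ᵇ_; ∑-sublists-⊆ᵇ)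
  open Stopping _≟E_
  open DecMembership _≟E_ using (_∈?_)

  module _ {S : List (Edge n)} (pm : IsPerfectMatching S) (uS : Unique S)
           (P : List (Edge n)) (e₀ : Edge n) (B : List (Edge n))
           (ω↭E : P ++ e₀ ∷ B ↭ allEdges n) (e₀∈S : e₀ ∈ S) (B∩S=∅ : All (_∉ S) B) where

    private
      ω : List (Edge n)
      ω = P ++ e₀ ∷ B

      ∈ω : ∀ f → f ∈ ω
      ∈ω f = ∈-resp-↭ (↭-sym ω↭E) (∈-allEdges f)

      e₀∉P : e₀ ∉ P
      e₀∉P = Unique-++-∷ P (Unique-resp-↭ (↭-sym ω↭E) Unique-allEdges)

      ∈S⇒∈P : ∀ {f} → f ∈ S → f ≢ e₀ → f ∈ P
      ∈S⇒∈P {f} f∈S f≢e₀ with ∈-++⁻ P (∈ω f)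
      ... | inj₁ f∈P = f∈P
      ... | inj₂ (here f≡e₀) = contradiction f≡e₀ f≢e₀
      ... | inj₂ (there f∈B) = contradiction f∈S (All.lookup B∩S=∅ f∈B)

    ∑-separates-last : ∀ (q : Edge n → Edge n → Bool) →
      ∑ (λ e → 𝟙 (inOrder q S e ω)) S ≡ 𝟙 (all (not ∘ q e₀) P)
    ∑-separates-last q = trans (∑-single S uS e₀∈S not-last) at-last
      where
      not-last : ∀ {e} → e ∈ S → e ≢ e₀ → 𝟙 (inOrder q S e ω) ≡ 0
      not-last {e} e∈S e≢e₀ = cong 𝟙 (trans (cong (all (not ∘ q e) (before e ω) ∧_) e₀-after-e) (∧-zeroʳ _))
        where
        e₀-after-e : all (not ∘ other S e) (after e ω) ≡ false
        e₀-after-e = trans (cong (all (not ∘ other S e)) (after-++ P (e₀ ∷ B) (∈S⇒∈P e∈S e≢e₀)))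
                           (all-∈-false (after e P ++ e₀ ∷ B) (∈-++⁺ʳ (after e P) (here refl))
                              (cong not (cong₂ _∧_ (dec-true (e₀ ∈? S) e₀∈S) (cong not (dec-false (e₀ ≟E e) (e≢e₀ ∘ sym))))))
      at-last : 𝟙 (inOrder q S e₀ ω) ≡ 𝟙 (all (not ∘ q e₀) P)
      at-last = cong 𝟙 (trans (cong₂ (λ α β → all (not ∘ q e₀) α ∧ all (not ∘ other S e₀) β)
                                     (before-++-∷ P B e₀∉P) (after-++-∷ P B e₀∉P))
                              (trans (cong (all (not ∘ q e₀) P ∧_) none-after) (∧-identityʳ _)))
        where
        none-after : all (not ∘ other S e₀) B ≡ true
        none-after = all-true B (λ {b} b∈B →
          cong (λ c → not (c ∧ not (does (b ≟E e₀)))) (dec-false (b ∈? S) (All.lookup B∩S=∅ b∈B)))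

    ⊆ᵇ-stopped⇔ : (S ⊆ᵇ stoppedGraph ω ≡ true) ⇔ (¬ NoIsolated P)
    ⊆ᵇ-stopped⇔ = mk⇔ to from
      where
      ∈-stopped⇔ : ∀ f → (f ∈ stoppedGraph ω) ⇔ (¬ NoIsolated (before f ω))
      ∈-stopped⇔ f = ∈-firstSat-inits noIsolated? NoIsolated-++ ω (∈ω f)
      to : S ⊆ᵇ stoppedGraph ω ≡ true → ¬ NoIsolated P
      to S⊆G = subst (¬_ ∘ NoIsolated) (before-++-∷ P B e₀∉P)
                     (Equivalence.to (∈-stopped⇔ e₀) (does-true (e₀ ∈? stoppedGraph ω) (all-lookup S S⊆G e₀∈S)))
      from : ¬ NoIsolated P → S ⊆ᵇ stoppedGraph ω ≡ true
      from ¬noIsoP = all-true S (λ {f} f∈S →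
        dec-true (f ∈? stoppedGraph ω) (Equivalence.from (∈-stopped⇔ f) (¬noIso-before f∈S)))
        where
        ¬noIso-before : ∀ {f} → f ∈ S → ¬ NoIsolated (before f ω)
        ¬noIso-before {f} f∈S with f ≟E e₀
        ... | yes refl = subst (¬_ ∘ NoIsolated) (sym (before-++-∷ P B e₀∉P)) ¬noIsoP
        ... | no f≢e₀ = λ noIso → ¬noIsoP (subst NoIsolated (before-after P f∈P)
                          (NoIsolated-++ (before f P) (f ∷ after f P) (subst NoIsolated (before-++ P (e₀ ∷ B) f∈P) noIso)))
          where
          f∈P : f ∈ P
          f∈P = ∈S⇒∈P f∈S f≢e₀

    isolated : Vertex n → Bool
    isolated v = all (not ∘ mate v e₀) P

    -- Every vertex other than the endpoints of e₀ is covered in P by its edge of S.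
    isolated⇔ : (¬ NoIsolated P) ⇔ (isolated (row e₀) ∨ isolated (col e₀) ≡ true)
    isolated⇔ = mk⇔ to from
      where
      mate-in-P : ∀ v {f} → f ∈ P → Incident v f → not (mate v e₀ f) ≡ false
      mate-in-P v {f} f∈P vf =
        cong not (cong₂ _∧_ (dec-true (incident? v f) vf) (cong not (dec-false (f ≟E e₀) (λ { refl → e₀∉P f∈P }))))
      ¬isolated⇒1≤degree : ∀ v → isolated v ≡ false → 1 ≤ degree v P
      ¬isolated⇒1≤degree v iso≡ with find (all-false P iso≡)
      ... | f , f∈P , ¬mate≡ = incident⇒1≤degree v P f∈P (does-true (incident? v f) (proj₁ (∧-true (not-false ¬mate≡))))
      unmatched⇒1≤degree : ∀ v → ¬ Incident v e₀ → 1 ≤ degree v P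
      unmatched⇒1≤degree v ¬ve₀ with matched pm v
      ... | g , g∈S , vg = incident⇒1≤degree v P (∈S⇒∈P g∈S (λ { refl → ¬ve₀ vg })) vg
      isolated⇒¬noIso : ∀ v → isolated v ≡ true → ¬ NoIsolated P
      isolated⇒¬noIso v iso≡ noIso =
        contradiction (subst (1 ≤_) (¬incident⇒degree≡0 v P ¬incident) (All.lookup noIso (∈-allVertices v))) λ ()
        where
        ¬incident : All (¬_ ∘ Incident v) P
        ¬incident = All.tabulate (λ f∈P vf →
          contradiction (trans (sym (all-lookup P iso≡ f∈P)) (mate-in-P v f∈P vf)) λ ())
      to : ¬ NoIsolated P → isolated (row e₀) ∨ isolated (col e₀) ≡ true
      to ¬noIso with isolated (row e₀) in isoR | isolated (col e₀) in isoC
      ... | true | _ = refl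
      ... | false | true = refl
      ... | false | false = contradiction (All.tabulate covered) ¬noIso
        where
        covered : ∀ {v} → v ∈ allVertices n → 1 ≤ degree v P
        covered {inj₁ i} _ with i ≟ᶠ proj₁ e₀
        ... | yes refl = ¬isolated⇒1≤degree (row e₀) isoR
        ... | no i≢ = unmatched⇒1≤degree (inj₁ i) (i≢ ∘ sym)
        covered {inj₂ j} _ with j ≟ᶠ proj₂ e₀
        ... | yes refl = ¬isolated⇒1≤degree (col e₀) isoC
        ... | no j≢ = unmatched⇒1≤degree (inj₂ j) (j≢ ∘ sym)
      from : isolated (row e₀) ∨ isolated (col e₀) ≡ true → ¬ NoIsolated P
      from iso≡ with isolated (row e₀) in isoR | isolated (col e₀) in isoC
      ... | true | _ = isolated⇒¬noIso (row e₀) isoR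
      ... | false | true = isolated⇒¬noIso (col e₀) isoC

    pointwise : 𝟙 (S ⊆ᵇ stoppedGraph ω) + ∑ (λ e → 𝟙 (inOrder mates S e ω)) S
                  ≡ ∑ (λ e → 𝟙 (inOrder rowMate S e ω) + 𝟙 (inOrder colMate S e ω)) S
    pointwise = begin
      𝟙 (S ⊆ᵇ stoppedGraph ω) + ∑ (λ e → 𝟙 (inOrder mates S e ω)) S
        ≡⟨ cong₂ _+_ (cong 𝟙 stopped≡isolated) (∑-separates-last mates) ⟩
      𝟙 (isolated (row e₀) ∨ isolated (col e₀)) + 𝟙 (all (not ∘ mates e₀) P)
        ≡⟨ cong (λ b → 𝟙 (isolated (row e₀) ∨ isolated (col e₀)) + 𝟙 b)
                (trans (all-cong P (λ {f} _ → not-∨ (rowMate e₀ f) (colMate e₀ f)))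
                       (all-∧ (not ∘ rowMate e₀) (not ∘ colMate e₀) P)) ⟩
      𝟙 (isolated (row e₀) ∨ isolated (col e₀)) + 𝟙 (isolated (row e₀) ∧ isolated (col e₀))
        ≡⟨ 𝟙-∨ (isolated (row e₀)) (isolated (col e₀)) ⟩
      𝟙 (isolated (row e₀)) + 𝟙 (isolated (col e₀))
        ≡⟨ cong₂ _+_ (∑-separates-last rowMate) (∑-separates-last colMate) ⟨
      ∑ (λ e → 𝟙 (inOrder rowMate S e ω)) S + ∑ (λ e → 𝟙 (inOrder colMate S e ω)) S
        ≡⟨ ∑-+ (λ e → 𝟙 (inOrder rowMate S e ω)) (λ e → 𝟙 (inOrder colMate S e ω)) S ⟨
      ∑ (λ e → 𝟙 (inOrder rowMate S e ω) + 𝟙 (inOrder colMate S e ω)) S ∎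
      where
      open ≡-Reasoning
      stopped≡isolated : S ⊆ᵇ stoppedGraph ω ≡ isolated (row e₀) ∨ isolated (col e₀)
      stopped≡isolated = true⇔true⇒≡ (Equivalence.to isolated⇔ ∘ Equivalence.to ⊆ᵇ-stopped⇔)
                                     (Equivalence.from ⊆ᵇ-stopped⇔ ∘ Equivalence.from isolated⇔)

  pointwise-↭ : ∀ {S} → IsPerfectMatching S → Unique S → ∀ {s} → s ∈ S → ∀ {ω} → ω ↭ allEdges n →
    𝟙 (S ⊆ᵇ stoppedGraph ω) + ∑ (λ e → 𝟙 (inOrder mates S e ω)) S
      ≡ ∑ (λ e → 𝟙 (inOrder rowMate S e ω) + 𝟙 (inOrder colMate S e ω)) S
  pointwise-↭ {S} pm uS {s} s∈S {ω} ω↭E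
    with last-split (_∈? S) ω (Any.map (λ s≡f → subst (_∈ S) s≡f s∈S) (∈-resp-↭ (↭-sym ω↭E) (∈-allEdges s)))
  ... | P , e₀ , B , refl , e₀∈S , B∩S=∅ = pointwise pm uS P e₀ B ω↭E e₀∈S B∩S=∅

-- The number of perfect matchings

module PerfectMatchingCount (n : ℕ) where
  open CompleteBipartite n

  rows : List (Fin n) → List (Edge n)
  rows Is = cartesianProduct Is (allFin n)

  matchesOnto : List (Fin n) → (Fin n → Bool) → List (Edge n) → Bool
  matchesOnto Is D S =
    all (λ i → does (degree (inj₁ i) S ≟ℕ 1)) Is ∧ all (λ j → does (degree (inj₂ j) S ≟ℕ 𝟙 (D j))) (allFin n)

  private
    degree-∷ : ∀ v f (S : List (Edge n)) → degree v (f ∷ S) ≡ 𝟙 (does (incident? v f)) + degree v S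
    degree-∷ v f S with does (incident? v f)
    ... | true = refl
    ... | false = refl

    remove : Fin n → (Fin n → Bool) → Fin n → Bool
    remove c D j = D j ∧ not (does (j ≟ᶠ c))

  module _ (i : Fin n) (Is : List (Fin n)) (i∉Is : All (i ≢_) Is) where

    private
      in-row-i : ∀ {S₁} → S₁ ∈ sublists (map (i ,_) (allFin n)) → All (Incident (inj₁ i)) S₁
      in-row-i S₁∈ = All.map (λ f∈ → case (∈-map⁻ (i ,_) f∈)) (∈-sublists⁻ _ S₁∈)
        where
        case : ∀ {f} → ∃ (λ c → c ∈ allFin n × f ≡ (i , c)) → proj₁ f ≡ i
        case (_ , _ , refl) = refl

      not-in-row-i : ∀ {S₂} → S₂ ∈ sublists (rows Is) → All (¬_ ∘ Incident (inj₁ i)) S₂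
      not-in-row-i S₂∈ = All.map (λ f∈ f₁≡i → All.lookup i∉Is (proj₁ (∈-cartesianProduct⁻ Is (allFin n) f∈)) (sym f₁≡i))
                              (∈-sublists⁻ (rows Is) S₂∈)

    degree-row : ∀ {S₁ S₂} → S₁ ∈ sublists (map (i ,_) (allFin n)) → S₂ ∈ sublists (rows Is) →
      degree (inj₁ i) (S₁ ++ S₂) ≡ length S₁
    degree-row {S₁} {S₂} S₁∈ S₂∈ = begin
      degree (inj₁ i) (S₁ ++ S₂)                    ≡⟨ degree-++ (inj₁ i) S₁ S₂ ⟩
      degree (inj₁ i) S₁ + degree (inj₁ i) S₂
        ≡⟨ cong₂ _+_ (cong length (filter-all (incident? (inj₁ i)) (in-row-i S₁∈)))
                                                                 (¬incident⇒degree≡0 (inj₁ i) S₂ (not-in-row-i S₂∈)) ⟩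
      length S₁ + 0                                 ≡⟨ +-comm (length S₁) 0 ⟩
      length S₁                                     ∎
      where open ≡-Reasoning

    matchesOnto-∷ : ∀ D c {S₂} → S₂ ∈ sublists (rows Is) →
      matchesOnto (i ∷ Is) D ((i , c) ∷ S₂) ≡ D c ∧ matchesOnto Is (remove c D) S₂
    matchesOnto-∷ D c {S₂} S₂∈ = begin
      (does (degree (inj₁ i) ((i , c) ∷ S₂) ≟ℕ 1) ∧ all (row-ok ((i , c) ∷ S₂)) Is)
        ∧ all (column-ok D ((i , c) ∷ S₂)) (allFin n)
        ≡⟨ cong₂ (λ a b → (a ∧ b) ∧ all (column-ok D ((i , c) ∷ S₂)) (allFin n)) row-i (all-cong Is other-rows) ⟩
      all (row-ok S₂) Is ∧ all (column-ok D ((i , c) ∷ S₂)) (allFin n)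
        ≡⟨ cong (all (row-ok S₂) Is ∧_) (all-single (D c) (allFin n) (allFin⁺ n) (∈-allFin c) other-columns column-c) ⟩
      all (row-ok S₂) Is ∧ (D c ∧ all (column-ok (remove c D) S₂) (allFin n))
        ≡⟨ ∧-left-comm (all (row-ok S₂) Is) (D c) _ ⟩
      D c ∧ matchesOnto Is (remove c D) S₂ ∎
      where
      open ≡-Reasoning
      row-ok : List (Edge n) → Fin n → Bool
      row-ok S i′ = does (degree (inj₁ i′) S ≟ℕ 1)
      column-ok : (Fin n → Bool) → List (Edge n) → Fin n → Bool
      column-ok D S j = does (degree (inj₂ j) S ≟ℕ 𝟙 (D j))
      row-i : does (degree (inj₁ i) ((i , c) ∷ S₂) ≟ℕ 1) ≡ true
      row-i = cong (λ d → does (d ≟ℕ 1))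
        (trans (degree-∷ (inj₁ i) (i , c) S₂)
               (cong₂ _+_ (cong 𝟙 (dec-true (i ≟ᶠ i) refl)) (¬incident⇒degree≡0 (inj₁ i) S₂ (not-in-row-i S₂∈))))
      other-rows : ∀ {i′} → i′ ∈ Is → row-ok ((i , c) ∷ S₂) i′ ≡ row-ok S₂ i′
      other-rows {i′} i′∈ = cong (λ d → does (d ≟ℕ 1))
        (trans (degree-∷ (inj₁ i′) (i , c) S₂)
               (cong (λ b → 𝟙 b + degree (inj₁ i′) S₂) (dec-false (i ≟ᶠ i′) (All.lookup i∉Is i′∈))))
      other-columns : ∀ {j} → j ∈ allFin n → j ≢ c → column-ok D ((i , c) ∷ S₂) j ≡ column-ok (remove c D) S₂ j
      other-columns {j} _ j≢c = cong₂ (λ d k → does (d ≟ℕ k))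
        (trans (degree-∷ (inj₂ j) (i , c) S₂) (cong (λ b → 𝟙 b + degree (inj₂ j) S₂) (dec-false (c ≟ᶠ j) (j≢c ∘ sym))))
        (cong 𝟙 (sym (trans (cong (λ b → D j ∧ not b) (dec-false (j ≟ᶠ c) j≢c)) (∧-identityʳ (D j)))))
      column-c : column-ok D ((i , c) ∷ S₂) c ≡ D c ∧ column-ok (remove c D) S₂ c
      column-c with c ≟ᶠ c | D c
      ... | yes _ | true = refl
      ... | yes _ | false = refl
      ... | no c≢c | _ = contradiction refl c≢c

  private
    ∑𝟙≡0 : ∀ (D : Fin n → Bool) js → ∑ (𝟙 ∘ D) js ≡ 0 → ∀ {j} → j ∈ js → D j ≡ false
    ∑𝟙≡0 D (j ∷ js) ∑≡0 (here refl) with D j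
    ... | false = refl
    ∑𝟙≡0 D (j′ ∷ js) ∑≡0 (there j∈) with D j′
    ... | false = ∑𝟙≡0 D js ∑≡0 j∈

  ∑-matchesOnto : ∀ Is → Unique Is → ∀ D → ∑ (𝟙 ∘ D) (allFin n) ≡ length Is →
    ∑ (𝟙 ∘ matchesOnto Is D) (sublists (rows Is)) ≡ length Is !
  ∑-matchesOnto [] [] D ∑D≡0 =
    cong (λ b → 𝟙 b + 0) (all-true (allFin n) (λ j∈ → cong (λ b → does (0 ≟ℕ 𝟙 b)) (∑𝟙≡0 D (allFin n) ∑D≡0 j∈)))
  ∑-matchesOnto (i ∷ Is) (i∉Is ∷ uIs) D ∑D≡ = begin
    ∑ h (sublists (X ++ rows Is))
      ≡⟨ ∑-sublists-++ h X (rows Is) ⟩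
    ∑ (λ S₁ → ∑ (λ S₂ → h (S₁ ++ S₂)) (sublists (rows Is))) (sublists X)
      ≡⟨ ∑-sublists-singletons _ X (λ S₁∈ |S₁|≢1 → ∑-zero (sublists (rows Is)) (λ S₂∈ → not-one S₁∈ S₂∈ |S₁|≢1)) ⟩
    ∑ (λ x → ∑ (λ S₂ → h (x ∷ S₂)) (sublists (rows Is))) X
      ≡⟨ ∑-map (λ x → ∑ (λ S₂ → h (x ∷ S₂)) (sublists (rows Is))) (i ,_) (allFin n) ⟩
    ∑ (λ c → ∑ (λ S₂ → h ((i , c) ∷ S₂)) (sublists (rows Is))) (allFin n)
      ≡⟨ ∑-cong (allFin n) (λ {c} _ → column c) ⟩
    ∑ (λ c → length Is ! * 𝟙 (D c)) (allFin n)
      ≡⟨ ∑-*ˡ (length Is !) (𝟙 ∘ D) (allFin n) ⟩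
    length Is ! * ∑ (𝟙 ∘ D) (allFin n)
      ≡⟨ cong (length Is ! *_) ∑D≡ ⟩
    length Is ! * suc (length Is)
      ≡⟨ *-comm (length Is !) (suc (length Is)) ⟩
    suc (length Is) ! ∎
    where
    open ≡-Reasoning
    X : List (Edge n)
    X = map (i ,_) (allFin n)
    h : List (Edge n) → ℕ
    h = 𝟙 ∘ matchesOnto (i ∷ Is) D
    not-one : ∀ {S₁ S₂} → S₁ ∈ sublists X → S₂ ∈ sublists (rows Is) → length S₁ ≢ 1 → h (S₁ ++ S₂) ≡ 0
    not-one {S₁} {S₂} S₁∈ S₂∈ |S₁|≢1 =
      cong (λ b → 𝟙 ((b ∧ all (λ i′ → does (degree (inj₁ i′) (S₁ ++ S₂) ≟ℕ 1)) Is)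
                     ∧ all (λ j → does (degree (inj₂ j) (S₁ ++ S₂) ≟ℕ 𝟙 (D j))) (allFin n)))
           (trans (cong (λ d → does (d ≟ℕ 1)) (degree-row i Is i∉Is S₁∈ S₂∈)) (dec-false (length S₁ ≟ℕ 1) |S₁|≢1))
    column : ∀ c → ∑ (λ S₂ → h ((i , c) ∷ S₂)) (sublists (rows Is)) ≡ length Is ! * 𝟙 (D c)
    column c = trans (∑-cong (sublists (rows Is)) (λ S₂∈ → trans (cong 𝟙 (matchesOnto-∷ i Is i∉Is D c S₂∈)) (𝟙-∧ (D c) _)))
                     (trans (∑-*ˡ (𝟙 (D c)) (𝟙 ∘ matchesOnto Is (remove c D)) (sublists (rows Is))) (available (D c) refl))
      where
      available : ∀ b → D c ≡ b → 𝟙 b * ∑ (𝟙 ∘ matchesOnto Is (remove c D)) (sublists (rows Is)) ≡ length Is ! * 𝟙 b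
      available false _ = sym (*-zeroʳ (length Is !))
      available true Dc = trans (+-comm _ 0) (trans (∑-matchesOnto Is uIs (remove c D) ∑remove≡) (sym (*-identityʳ _)))
        where
        ∑remove≡ : ∑ (𝟙 ∘ remove c D) (allFin n) ≡ length Is
        ∑remove≡ = suc-injective (trans (+-comm 1 _) (trans (cong (λ b → ∑ (𝟙 ∘ remove c D) (allFin n) + 𝟙 b) (sym Dc))
                     (trans (Counting.∑-minus-one _≟ᶠ_ D (allFin n) (allFin⁺ n) (∈-allFin c)) ∑D≡)))

  count-perfect-matchings : ∑ (λ S → 𝟙 (does (isPerfectMatching? S))) (sublists (allEdges n)) ≡ n !
  count-perfect-matchings = begin
    ∑ (λ S → 𝟙 (does (isPerfectMatching? S))) (sublists (allEdges n))
      ≡⟨ ∑-cong (sublists (allEdges n)) (λ {S} _ → cong 𝟙 (perfect⇔onto S)) ⟩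
    ∑ (𝟙 ∘ matchesOnto (allFin n) (λ _ → true)) (sublists (rows (allFin n)))
      ≡⟨ ∑-matchesOnto (allFin n) (allFin⁺ n) (λ _ → true) (sym (length≡∑1 (allFin n))) ⟩
    length (allFin n) !
      ≡⟨ cong _! length-allFin ⟩
    n ! ∎
    where
    open ≡-Reasoning
    perfect⇔onto : ∀ S → does (isPerfectMatching? S) ≡ matchesOnto (allFin n) (λ _ → true) S
    perfect⇔onto S = trans (does-all? (λ v → degree v S ≟ℕ 1) (allVertices n))
      (trans (all-++ (λ v → does (degree v S ≟ℕ 1)) (map inj₁ (allFin n)) (map inj₂ (allFin n)))
             (cong₂ _∧_ (all-map (λ v → does (degree v S ≟ℕ 1)) inj₁ (allFin n))
                        (all-map (λ v → does (degree v S ≟ℕ 1)) inj₂ (allFin n))))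

C-factorials : ∀ k j → ((k + j) C k) * (k ! * j !) ≡ (k + j) !
C-factorials k j = begin
  ((k + j) C k) * (k ! * j !)                ≡⟨ cong (λ d → ((k + j) C k) * (k ! * d !)) (sym (m+n∸m≡n k j)) ⟩
  ((k + j) C k) * (k ! * (k + j ∸ k) !)      ≡⟨ cong (_* (k ! * (k + j ∸ k) !)) (nCk≡n!/k![n-k]! (m≤m+n k j)) ⟩
  ((k + j) ! / (k ! * (k + j ∸ k) !)) {{k !* (k + j ∸ k) !≢0}} * (k ! * (k + j ∸ k) !)
                                             ≡⟨ m/n*n≡m {{k !* (k + j ∸ k) !≢0}} (k![n∸k]!∣n! (m≤m+n k j)) ⟩
  (k + j) !                                  ∎
  where open ≡-Reasoning

C≢0 : ∀ k j → (k + j) C k ≢ 0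
C≢0 k j C≡0 = ≢-nonZero⁻¹ ((k + j) !) {{(k + j) !≢0}} (trans (sym (C-factorials k j)) (cong (_* (k ! * j !)) C≡0))

two-n∸1 : ∀ m → 2 * suc m ∸ 1 ≡ suc m + m
two-n∸1 m = cong (_∸ 1) (double m)
  where
  double : ∀ m → 2 * suc m ≡ suc (suc m + m)
  double = solve-∀

three-n∸2 : ∀ m → 3 * suc m ∸ 2 ≡ suc m + (m + m)
three-n∸2 m = cong (_∸ 2) (triple m)
  where
  triple : ∀ m → 3 * suc m ≡ suc (suc (suc m + (m + m)))
  triple = solve-∀

-- The expected number of perfect matchings

module Expectation (m : ℕ) where

  n : ℕ
  n = suc m

  open CompleteBipartite n
  open LastMatchingEdge n
  open PerfectMatchingCount n
  open Pivot _≟E_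
  open Counting _≟E_ using (_⊆ᵇ_; ∑-sublists-⊆ᵇ)
  open DecMembership _≟E_ using (_∈?_)

  perfect : List (Edge n) → ℕ
  perfect S = 𝟙 (does (isPerfectMatching? S))

  perfect-↭ : ∀ {S S′} → S ↭ S′ → perfect S ≡ perfect S′
  perfect-↭ {S} {S′} S↭S′ =
    cong 𝟙 (does-⇔ (mk⇔ (All.map (λ {v} d → trans (sym (degree-↭ v)) d)) (All.map (λ {v} d → trans (degree-↭ v) d)))
                                          (isPerfectMatching? S) (isPerfectMatching? S′))
    where
    degree-↭ : ∀ (v : Vertex n) → degree v S ≡ degree v S′
    degree-↭ v = ↭-length (filter-↭ (incident? v) S↭S′)

  numPerfectMatchings-stopped : ∀ {ω} → ω ↭ allEdges n →
    numPerfectMatchings (stoppedGraph ω) ≡ ∑ (λ S → perfect S * 𝟙 (S ⊆ᵇ stoppedGraph ω)) (sublists (allEdges n))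
  numPerfectMatchings-stopped {ω} ω↭E with firstSat-inits-++ noIsolated? ω
  ... | R , G++R≡ω = begin
    numPerfectMatchings G                                   ≡⟨ length-filter isPerfectMatching? (sublists G) ⟩
    ∑ perfect (sublists G)                                  ≡⟨ ∑-sublists-⊆ᵇ G R Unique-G++R perfect ⟨
    ∑ (λ S → perfect S * 𝟙 (S ⊆ᵇ G)) (sublists (G ++ R))
      ≡⟨ ∑-sublists-↭ (λ S → perfect S * 𝟙 (S ⊆ᵇ G)) invariant G++R↭E ⟩
    ∑ (λ S → perfect S * 𝟙 (S ⊆ᵇ G)) (sublists (allEdges n)) ∎
    where
    open ≡-Reasoning
    G : List (Edge n)
    G = stoppedGraph ω
    G++R↭E : G ++ R ↭ allEdges n
    G++R↭E = subst (_↭ allEdges n) (sym G++R≡ω) ω↭E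
    Unique-G++R : Unique (G ++ R)
    Unique-G++R = Unique-resp-↭ (↭-sym G++R↭E) Unique-allEdges
    invariant : ∀ {S S′} → S ↭ S′ → perfect S * 𝟙 (S ⊆ᵇ G) ≡ perfect S′ * 𝟙 (S′ ⊆ᵇ G)
    invariant S↭S′ = cong₂ _*_ (perfect-↭ S↭S′) (cong 𝟙 (all-↭ _ S↭S′))

  total : ℕ
  total = ∑ (λ ω → numPerfectMatchings (stoppedGraph ω)) (orderings n)

  N! : ℕ
  N! = length (allEdges n) !

  C₁ C₂ : ℕ
  C₁ = (n + m) C n
  C₂ = (n + (m + m)) C n

  stoppedCount : List (Edge n) → ℕ
  stoppedCount S = ∑ (λ ω → 𝟙 (S ⊆ᵇ stoppedGraph ω)) (orderings n)

  ∑-numPerfectMatchings : total ≡ ∑ (λ S → perfect S * stoppedCount S) (sublists (allEdges n))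
  ∑-numPerfectMatchings = begin
    ∑ (λ ω → numPerfectMatchings (stoppedGraph ω)) (orderings n)
      ≡⟨ ∑-cong (orderings n) (λ ω∈ → numPerfectMatchings-stopped (↭-permutations (allEdges n) ω∈)) ⟩
    ∑ (λ ω → ∑ (λ S → perfect S * 𝟙 (S ⊆ᵇ stoppedGraph ω)) (sublists (allEdges n))) (orderings n)
      ≡⟨ ∑-comm (λ ω S → perfect S * 𝟙 (S ⊆ᵇ stoppedGraph ω)) (orderings n) (sublists (allEdges n)) ⟩
    ∑ (λ S → ∑ (λ ω → perfect S * 𝟙 (S ⊆ᵇ stoppedGraph ω)) (orderings n)) (sublists (allEdges n))
      ≡⟨ ∑-cong (sublists (allEdges n)) (λ {S} _ → ∑-*ˡ (perfect S) (λ ω → 𝟙 (S ⊆ᵇ stoppedGraph ω)) (orderings n)) ⟩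
    ∑ (λ S → perfect S * stoppedCount S) (sublists (allEdges n)) ∎
    where open ≡-Reasoning

  module _ {S : List (Edge n)} (pm : IsPerfectMatching S) (uS : Unique S) where

    inOrderCount : (Edge n → Edge n → Bool) → Edge n → ℕ
    inOrderCount q e = ∑ (λ ω → 𝟙 (inOrder q S e ω)) (orderings n)

    inOrderCount-C : ∀ q k {e} → e ∈ S → q e e ≡ false → (∀ f → other S e f ≡ true → q e f ≡ false) →
      ∑ (𝟙 ∘ q e) (allEdges n) ≡ k → inOrderCount q e * (n * ((n + k) C n)) ≡ N!
    inOrderCount-C q k {e} e∈S qee other⇒¬q ∑q≡k = *-cancelʳ-≡ _ _ (m ! * k !) {{m !* k !≢0}} (begin
      inOrderCount q e * (n * ((n + k) C n)) * (m ! * k !)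
        ≡⟨ regroup (inOrderCount q e) n ((n + k) C n) (m !) (k !) ⟩
      inOrderCount q e * (((n + k) C n) * (n ! * k !))      ≡⟨ cong (inOrderCount q e *_) (C-factorials n k) ⟩
      inOrderCount q e * (n + k) !                          ≡⟨ separated ⟩
      N! * (m ! * k !)                                      ∎)
      where
      open ≡-Reasoning
      regroup : ∀ a n c x y → a * (n * c) * (x * y) ≡ a * (c * (n * x * y))
      regroup = solve-∀
      separated : inOrderCount q e * (n + k) ! ≡ N! * (m ! * k !)
      separated = subst₂ (λ c d → inOrderCount q e * suc (c + d) ! ≡ N! * (c ! * d !))
                         (suc-injective (count-other pm uS e∈S)) ∑q≡k
                         (Separation.∑-separates-count (other S e) (q e) e other⇒¬q (∧-not-self _ e) qee
                            (allEdges n) Unique-allEdges (∈-allEdges e))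

    stoppedCount-identity : stoppedCount S * C₁ * C₂ + N! * C₁ ≡ (N! + N!) * C₂
    stoppedCount-identity = *-cancelʳ-≡ _ _ (n * n) (begin
      (K * C₁ * C₂ + N! * C₁) * (n * n)                  ≡⟨ expand K N! C₁ C₂ n ⟩
      K * (D₁ * D₂) + n * N! * D₁                        ≡⟨ cong (λ t → K * (D₁ * D₂) + t * D₁) (sym ∑b) ⟩
      K * (D₁ * D₂) + ∑ b S * D₂ * D₁                    ≡⟨ distribute K (∑ b S) D₁ D₂ ⟩
      (K + ∑ b S) * (D₁ * D₂)                            ≡⟨ cong (_* (D₁ * D₂)) pointwise-∑ ⟩
      ∑ (λ e → a-row e + a-col e) S * (D₁ * D₂)          ≡⟨ *-assoc (∑ (λ e → a-row e + a-col e) S) D₁ D₂ ⟨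
      ∑ (λ e → a-row e + a-col e) S * D₁ * D₂            ≡⟨ cong (_* D₂) ∑a ⟩
      n * (N! + N!) * D₂                                 ≡⟨ contract N! C₂ n ⟩
      (N! + N!) * C₂ * (n * n)                           ∎)
      where
      open ≡-Reasoning
      K D₁ D₂ : ℕ
      K = stoppedCount S
      D₁ = n * C₁
      D₂ = n * C₂
      a-row a-col b : Edge n → ℕ
      a-row = inOrderCount rowMate
      a-col = inOrderCount colMate
      b = inOrderCount mates
      expand : ∀ K N C₁ C₂ n → (K * C₁ * C₂ + N * C₁) * (n * n) ≡ K * (n * C₁ * (n * C₂)) + n * N * (n * C₁)
      expand = solve-∀
      distribute : ∀ K B D₁ D₂ → K * (D₁ * D₂) + B * D₂ * D₁ ≡ (K + B) * (D₁ * D₂)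
      distribute = solve-∀
      contract : ∀ N C₂ n → n * (N + N) * (n * C₂) ≡ (N + N) * C₂ * (n * n)
      contract = solve-∀
      matched-edge : ∃ λ s → s ∈ S × Incident (inj₁ zero) s
      matched-edge = matched {S = S} pm (inj₁ zero)
      pointwise-∑ : K + ∑ b S ≡ ∑ (λ e → a-row e + a-col e) S
      pointwise-∑ = begin
        K + ∑ b S
          ≡⟨ cong (K +_) (∑-comm (λ e ω → 𝟙 (inOrder mates S e ω)) S (orderings n)) ⟩
        K + ∑ (λ ω → ∑ (λ e → 𝟙 (inOrder mates S e ω)) S) (orderings n)
          ≡⟨ ∑-+ (λ ω → 𝟙 (S ⊆ᵇ stoppedGraph ω)) (λ ω → ∑ (λ e → 𝟙 (inOrder mates S e ω)) S) (orderings n) ⟨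
        ∑ (λ ω → 𝟙 (S ⊆ᵇ stoppedGraph ω) + ∑ (λ e → 𝟙 (inOrder mates S e ω)) S) (orderings n)
          ≡⟨ ∑-cong (orderings n) (λ ω∈ → pointwise-↭ pm uS (proj₁ (proj₂ matched-edge)) (↭-permutations (allEdges n) ω∈)) ⟩
        ∑ (λ ω → ∑ (λ e → 𝟙 (inOrder rowMate S e ω) + 𝟙 (inOrder colMate S e ω)) S) (orderings n)
          ≡⟨ ∑-comm (λ ω e → 𝟙 (inOrder rowMate S e ω) + 𝟙 (inOrder colMate S e ω)) (orderings n) S ⟩
        ∑ (λ e → ∑ (λ ω → 𝟙 (inOrder rowMate S e ω) + 𝟙 (inOrder colMate S e ω)) (orderings n)) S
          ≡⟨ ∑-cong S (λ {e} _ → ∑-+ (λ ω → 𝟙 (inOrder rowMate S e ω)) (λ ω → 𝟙 (inOrder colMate S e ω)) (orderings n)) ⟩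
        ∑ (λ e → a-row e + a-col e) S ∎
      ∑b : ∑ b S * D₂ ≡ n * N!
      ∑b = trans (∑-scaled b D₂ N! S (λ {e} e∈S →
                    inOrderCount-C mates (m + m) e∈S
                      (cong₂ _∨_ (∧-not-self (does (incident? (row e) e)) e) (∧-not-self (does (incident? (col e) e)) e))
                      (other⇒¬mates pm uS e∈S)
                                   (suc-injective (suc-injective (trans (count-mates e) (+-suc n m)))))) 
                 (cong (_* N!) (length-matching {S = S} pm))
      ∑a : ∑ (λ e → a-row e + a-col e) S * D₁ ≡ n * (N! + N!)
      ∑a = trans (∑-scaled (λ e → a-row e + a-col e) D₁ (N! + N!) S (λ {e} e∈S →
                    trans (*-distribʳ-+ D₁ (a-row e) (a-col e))
                          (cong₂ _+_ (inOrderCount-C rowMate m e∈S (∧-not-self _ e) (other⇒¬mate pm uS e∈S (row e) refl)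
                                                     (suc-injective (count-mate (row e) e refl)))
                                     (inOrderCount-C colMate m e∈S (∧-not-self _ e) (other⇒¬mate pm uS e∈S (col e) refl)
                                                     (suc-injective (count-mate (col e) e refl))))))
                 (cong (_* (N! + N!)) (length-matching {S = S} pm))

  total-identity : total * C₁ * C₂ + n ! * (N! * C₁) ≡ n ! * ((N! + N!) * C₂)
  total-identity = begin
    total * C₁ * C₂ + n ! * (N! * C₁)
      ≡⟨ cong₂ _+_ (cong (λ t → t * C₁ * C₂) ∑-numPerfectMatchings) (cong (_* (N! * C₁)) (sym count-perfect-matchings)) ⟩
    ∑ (λ S → perfect S * stoppedCount S) Ss * C₁ * C₂ + ∑ perfect Ss * (N! * C₁)
      ≡⟨ cong₂ _+_ (trans (*-assoc (∑ (λ S → perfect S * stoppedCount S) Ss) C₁ C₂)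
                          (∑-*ʳ (λ S → perfect S * stoppedCount S) (C₁ * C₂) Ss))
                   (∑-*ʳ perfect (N! * C₁) Ss) ⟩
    ∑ (λ S → perfect S * stoppedCount S * (C₁ * C₂)) Ss + ∑ (λ S → perfect S * (N! * C₁)) Ss
      ≡⟨ ∑-+ (λ S → perfect S * stoppedCount S * (C₁ * C₂)) (λ S → perfect S * (N! * C₁)) Ss ⟨
    ∑ (λ S → perfect S * stoppedCount S * (C₁ * C₂) + perfect S * (N! * C₁)) Ss
      ≡⟨ ∑-cong Ss (λ {S} S∈ → per-sublist S (Unique-sublists (allEdges n) Unique-allEdges S∈)) ⟩
    ∑ (λ S → perfect S * ((N! + N!) * C₂)) Ss
      ≡⟨ ∑-*ʳ perfect ((N! + N!) * C₂) Ss ⟨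
    ∑ perfect Ss * ((N! + N!) * C₂)
      ≡⟨ cong (_* ((N! + N!) * C₂)) count-perfect-matchings ⟩
    n ! * ((N! + N!) * C₂) ∎
    where
    open ≡-Reasoning
    Ss : List (List (Edge n))
    Ss = sublists (allEdges n)
    per-sublist : ∀ S → Unique S →
      𝟙 (does (isPerfectMatching? S)) * stoppedCount S * (C₁ * C₂) + 𝟙 (does (isPerfectMatching? S)) * (N! * C₁)
        ≡ 𝟙 (does (isPerfectMatching? S)) * ((N! + N!) * C₂)
    per-sublist S uS = by-cases (does (isPerfectMatching? S)) (does-true (isPerfectMatching? S))
      where
      by-cases : ∀ b → (b ≡ true → IsPerfectMatching S) →
        𝟙 b * stoppedCount S * (C₁ * C₂) + 𝟙 b * (N! * C₁) ≡ 𝟙 b * ((N! + N!) * C₂)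
      by-cases false _ = refl
      by-cases true pm =
        trans (regroup (stoppedCount S) C₁ C₂ N!) (trans (stoppedCount-identity (pm refl) uS) (sym (+-identityʳ _)))
        where
        regroup : ∀ K C₁ C₂ N → (K + 0) * (C₁ * C₂) + (N * C₁ + 0) ≡ K * C₁ * C₂ + N * C₁
        regroup = solve-∀

ℕtoℚ-mkℚ : ∀ a → ℕtoℚ a ≡ ℚ.mkℚ (ℤ.+ a) 0 (Coprimality.sym (Coprimality.1-coprimeTo a))
ℕtoℚ-mkℚ a = ℚₚ.normalize-coprime (Coprimality.sym (Coprimality.1-coprimeTo a))

ℕtoℚ-+ : ∀ a b → ℕtoℚ (a + b) ≡ ℕtoℚ a ℚ.+ ℕtoℚ b
ℕtoℚ-+ a b rewrite ℕtoℚ-mkℚ a | ℕtoℚ-mkℚ b =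
  cong (ℚ._/ 1) (trans (ℤₚ.pos-+ a b) (sym (cong₂ ℤ._+_ (ℤₚ.*-identityʳ (ℤ.+ a)) (ℤₚ.*-identityʳ (ℤ.+ b)))))

ℕtoℚ-* : ∀ a b → ℕtoℚ (a * b) ≡ ℕtoℚ a ℚ.* ℕtoℚ b
ℕtoℚ-* a b rewrite ℕtoℚ-mkℚ a | ℕtoℚ-mkℚ b = cong (ℚ._/ 1) (ℤₚ.pos-* a b)

ℕtoℚ-≢0 : ∀ {a} → a ≢ 0 → ℕtoℚ a ≢ ℚ.0ℚ
ℕtoℚ-≢0 {zero} a≢0 = contradiction refl a≢0
ℕtoℚ-≢0 {suc a} _ eq with trans (sym (ℕtoℚ-mkℚ (suc a))) eq
... | ()

/ℚ-≡ : ∀ p {q} (q≢0 : q ≢ ℚ.0ℚ) → p /ℚ q ≡ p ℚ.* (ℚ.1/ q) {{ℚ.≢-nonZero q≢0}}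
/ℚ-≡ p {q} q≢0 with q ℚₚ.≟ ℚ.0ℚ
... | yes q≡0 = contradiction q≡0 q≢0
... | no _ = refl

ratio-from-identity : ∀ T F N c₁ c₂ → N ≢ 0 → c₁ ≢ 0 → c₂ ≢ 0 →
  T * c₁ * c₂ + F * (N * c₁) ≡ F * ((N + N) * c₂) →
  ℕtoℚ T /ℚ ℕtoℚ N ≡ ℕtoℚ F ℚ.* ((ℕtoℚ 2 /ℚ ℕtoℚ c₁) - (ℕtoℚ 1 /ℚ ℕtoℚ c₂))
ratio-from-identity T F N c₁ c₂ N≢0 c₁≢0 c₂≢0 identity = begin
  t /ℚ n
    ≡⟨ /ℚ-≡ t n≢0 ⟩
  t ℚ.* u
    ≡⟨ trans (sym (ℚₚ.*-identityʳ (t ℚ.* u)))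
             (cong₂ (λ x y → t ℚ.* u ℚ.* (x ℚ.* y)) (sym (ℚₚ.*-inverseʳ a)) (sym (ℚₚ.*-inverseʳ b))) ⟩
  t ℚ.* u ℚ.* ((a ℚ.* v) ℚ.* (b ℚ.* w))
    ≡⟨ solve 6 (λ t u a v b w → t :* u :* ((a :* v) :* (b :* w)) := (t :* a :* b) :* (u :* v :* w)) refl t u a v b w ⟩
  (t ℚ.* a ℚ.* b) ℚ.* (u ℚ.* v ℚ.* w)
    ≡⟨ cong (ℚ._* (u ℚ.* v ℚ.* w)) (solve-for-first (t ℚ.* a ℚ.* b) (f ℚ.* (n ℚ.* a)) identityℚ) ⟩
  (f ℚ.* ((n ℚ.+ n) ℚ.* b) - f ℚ.* (n ℚ.* a)) ℚ.* (u ℚ.* v ℚ.* w)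
    ≡⟨ solve 7 (λ f n a b u v w → (f :* ((n :+ n) :* b) :- f :* (n :* a)) :* (u :* v :* w)
                                  := f :* ((n :* u) :* (b :* w) :* (v :+ v) :- (n :* u) :* (a :* v) :* w))
               refl f n a b u v w ⟩
  f ℚ.* ((n ℚ.* u) ℚ.* (b ℚ.* w) ℚ.* (v ℚ.+ v) - (n ℚ.* u) ℚ.* (a ℚ.* v) ℚ.* w)
    ≡⟨ cong₃ (λ x y z → f ℚ.* (x ℚ.* y ℚ.* (v ℚ.+ v) - x ℚ.* z ℚ.* w))
             (ℚₚ.*-inverseʳ n) (ℚₚ.*-inverseʳ b) (ℚₚ.*-inverseʳ a) ⟩
  f ℚ.* (ℚ.1ℚ ℚ.* ℚ.1ℚ ℚ.* (v ℚ.+ v) - ℚ.1ℚ ℚ.* ℚ.1ℚ ℚ.* w)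
    ≡⟨ solve 3 (λ f v w → f :* (con ℚ.1ℚ :* con ℚ.1ℚ :* (v :+ v) :- con ℚ.1ℚ :* con ℚ.1ℚ :* w)
                        := f :* ((con ℚ.1ℚ :+ con ℚ.1ℚ) :* v :- con ℚ.1ℚ :* w)) refl f v w ⟩
  f ℚ.* ((ℚ.1ℚ ℚ.+ ℚ.1ℚ) ℚ.* v - ℚ.1ℚ ℚ.* w)
    ≡⟨ cong₂ (λ x y → f ℚ.* (x - y)) (sym (/ℚ-≡ (ℕtoℚ 2) a≢0)) (sym (/ℚ-≡ (ℕtoℚ 1) b≢0)) ⟩
  f ℚ.* ((ℕtoℚ 2 /ℚ a) - (ℕtoℚ 1 /ℚ b)) ∎
  where
  open ≡-Reasoning
  open +-*-Solver
  t f n a b : ℚ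
  t = ℕtoℚ T
  f = ℕtoℚ F
  n = ℕtoℚ N
  a = ℕtoℚ c₁
  b = ℕtoℚ c₂
  n≢0 : n ≢ ℚ.0ℚ
  n≢0 = ℕtoℚ-≢0 N≢0
  a≢0 : a ≢ ℚ.0ℚ
  a≢0 = ℕtoℚ-≢0 c₁≢0
  b≢0 : b ≢ ℚ.0ℚ
  b≢0 = ℕtoℚ-≢0 c₂≢0
  instance
    n-nonZero : ℚ.NonZero n
    n-nonZero = ℚ.≢-nonZero n≢0
    a-nonZero : ℚ.NonZero a
    a-nonZero = ℚ.≢-nonZero a≢0
    b-nonZero : ℚ.NonZero b
    b-nonZero = ℚ.≢-nonZero b≢0
  u v w : ℚ
  u = ℚ.1/ n
  v = ℚ.1/ a
  w = ℚ.1/ b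
  cong₃ : ∀ (g : ℚ → ℚ → ℚ → ℚ) {x x′ y y′ z z′} → x ≡ x′ → y ≡ y′ → z ≡ z′ → g x y z ≡ g x′ y′ z′
  cong₃ g refl refl refl = refl
  identityℚ : t ℚ.* a ℚ.* b ℚ.+ f ℚ.* (n ℚ.* a) ≡ f ℚ.* ((n ℚ.+ n) ℚ.* b)
  identityℚ = begin
    t ℚ.* a ℚ.* b ℚ.+ f ℚ.* (n ℚ.* a)
      ≡⟨ cong₂ ℚ._+_ (trans (ℕtoℚ-* (T * c₁) c₂) (cong (ℚ._* b) (ℕtoℚ-* T c₁)))
                     (trans (ℕtoℚ-* F (N * c₁)) (cong (f ℚ.*_) (ℕtoℚ-* N c₁))) ⟨
    ℕtoℚ (T * c₁ * c₂) ℚ.+ ℕtoℚ (F * (N * c₁))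
      ≡⟨ ℕtoℚ-+ (T * c₁ * c₂) (F * (N * c₁)) ⟨
    ℕtoℚ (T * c₁ * c₂ + F * (N * c₁))
      ≡⟨ cong ℕtoℚ identity ⟩
    ℕtoℚ (F * ((N + N) * c₂))
      ≡⟨ trans (ℕtoℚ-* F ((N + N) * c₂)) (cong (f ℚ.*_) (trans (ℕtoℚ-* (N + N) c₂) (cong (ℚ._* b) (ℕtoℚ-+ N N)))) ⟩
    f ℚ.* ((n ℚ.+ n) ℚ.* b) ∎
  solve-for-first : ∀ x y {z} → x ℚ.+ y ≡ z → x ≡ z - y
  solve-for-first x y x+y≡z = trans (solve 2 (λ x y → x := x :+ y :- y) refl x y) (cong (_- y) x+y≡z)

corollary1 : (n : ℕ) → 1 ≤ n →
    expectedPM n ≡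
    ℕtoℚ (n !) ℚ.* ((ℕtoℚ 2 /ℚ ℕtoℚ ((2 * n ∸ 1) C n)) - (ℕtoℚ 1 /ℚ ℕtoℚ ((3 * n ∸ 2) C n)))
corollary1 (suc m) _ = begin
  expectedPM (suc m)
    ≡⟨ cong (λ N → ℕtoℚ total /ℚ ℕtoℚ N) (length-permutations (allEdges (suc m))) ⟩
  ℕtoℚ total /ℚ ℕtoℚ N!
    ≡⟨ ratio-from-identity total (suc m !) N! C₁ C₂ (≢-nonZero⁻¹ N! {{length (allEdges (suc m)) !≢0}})
                           (C≢0 (suc m) m) (C≢0 (suc m) (m + m)) total-identity ⟩
  ℕtoℚ (suc m !) ℚ.* ((ℕtoℚ 2 /ℚ ℕtoℚ C₁) - (ℕtoℚ 1 /ℚ ℕtoℚ C₂))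
    ≡⟨ cong₂ (λ a b → ℕtoℚ (suc m !) ℚ.* ((ℕtoℚ 2 /ℚ ℕtoℚ (a C suc m)) - (ℕtoℚ 1 /ℚ ℕtoℚ (b C suc m))))
             (sym (two-n∸1 m)) (sym (three-n∸2 m)) ⟩
  ℕtoℚ (suc m !) ℚ.* ((ℕtoℚ 2 /ℚ ℕtoℚ ((2 * suc m ∸ 1) C suc m)) - (ℕtoℚ 1 /ℚ ℕtoℚ ((3 * suc m ∸ 2) C suc m))) ∎
  where
  open ≡-Reasoning
  open Expectation m
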